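{- Let $d\ge 1$ and let $\Delta$ be a flag simplicial pseudomanifold of dimension $d-1$. Then the graph $\mathcal{G}(\Delta)$ is $(2d-2)$-connected.
   Context: All simplicial complexes are finite abstract simplicial complexes. A simplicial complex $\Delta$ is flag if every minimal non-face of $\Delta$ has at most two elements (equivalently, every set of vertices pairwise joined by edges is a face). A sequence $(\tau_0,\dots,\tau_n)$ of facets is a strong chain if $\tau_{i-1}\cap\tau_i$ is a codimension one face of both $\tau_{i-1}$ and $\tau_i$ for all $i$; $\Delta$ is strongly connected if any two facets can be joined by a strong chain (in particular $\Delta$ is pure). A $(d-1)$-dimensional simplicial complex is a pseudomanifold if it is strongly connected and each $(d-2)$-dimensional face lies in exactly two facets. The graph $\mathcal{G}(\Delta)$ is the $1$-skeleton of $\Delta$. For a positive integer $m$, a graph is $m$-connected if it has at least $m+1$ nodes and remains connected after deleting any set of fewer than $m$ nodes together with their incident edges. -}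

module Defs where

open import Data.Nat using (ℕ; suc; _+_; _∸_; _≤_; _<_)
open import Data.Bool using (Bool; true; false; T)
open import Data.Fin using (Fin)
open import Data.Fin.Subset using (Subset; _∈_; _∉_; _⊆_; _∩_; _∪_; ∣_∣; ⁅_⁆)
open import Data.Product using (Σ; ∃; _×_; _,_)
open import Data.Sum using (_⊎_)
open import Relation.Nullary using (¬_)
open import Relation.Binary.PropositionalEquality using (_≡_; _≢_)

-- We require downward closure and that every vertex {i} is a face
-- (so the vertex set of the complex is exactly Fin n).
record SimplicialComplex (n : ℕ) : Set where
  field
    isFace       : Subset n → Bool
    downClosed   : ∀ {σ τ : Subset n} → σ ⊆ τ → T (isFace τ) → T (isFace σ)
    vertexFace   : ∀ (i : Fin n) → T (isFace ⁅ i ⁆)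

module _ {n : ℕ} (Δ : SimplicialComplex n) where
  open SimplicialComplex Δ

  Face : Subset n → Set
  Face σ = T (isFace σ)

  Facet : Subset n → Set
  Facet σ = Face σ × (∀ τ → Face τ → σ ⊆ τ → τ ≡ σ)

  HasDimension : ℕ → Set   -- argument is d, i.e. dimension d - 1
  HasDimension d = (∃ λ σ → Face σ × ∣ σ ∣ ≡ d) × (∀ σ → Face σ → ∣ σ ∣ ≤ d)

  Adjacent : Subset n → Subset n → Set
  Adjacent σ τ = (∣ σ ∩ τ ∣ + 1 ≡ ∣ σ ∣) × (∣ σ ∩ τ ∣ + 1 ≡ ∣ τ ∣)

  data StrongChain : Subset n → Subset n → Set where
    [_]  : ∀ {σ} → Facet σ → StrongChain σ σ
    _∷_  : ∀ {σ τ ρ} → (Facet σ × Adjacent σ τ) → StrongChain τ ρ → StrongChain σ ρ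

  StronglyConnected : Set
  StronglyConnected = ∀ σ τ → Facet σ → Facet τ → StrongChain σ τ

  IsPseudomanifold : ℕ → Set
  IsPseudomanifold d =
    HasDimension d × StronglyConnected ×
    (∀ ρ → Face ρ → ∣ ρ ∣ ≡ d ∸ 1 →
      ∃ λ σ₁ → ∃ λ σ₂ →
        Facet σ₁ × Facet σ₂ × σ₁ ≢ σ₂ × ρ ⊆ σ₁ × ρ ⊆ σ₂ ×
        (∀ τ → Facet τ → ρ ⊆ τ → τ ≡ σ₁ ⊎ τ ≡ σ₂))

  Edge : Fin n → Fin n → Set
  Edge i j = i ≢ j × Face (⁅ i ⁆ ∪ ⁅ j ⁆)

  IsFlag : Set
  IsFlag = ∀ σ → (∀ i j → i ∈ σ → j ∈ σ → i ≢ j → Edge i j) → Face σ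

module _ {n : ℕ} (E : Fin n → Fin n → Set) where

  data PathAvoiding (R : Subset n) : Fin n → Fin n → Set where
    here  : ∀ {u} → u ∉ R → PathAvoiding R u u
    step  : ∀ {u v w} → u ∉ R → E u v → PathAvoiding R v w → PathAvoiding R u w

  IsConnectedGraph : ℕ → Set
  IsConnectedGraph m =
    m + 1 ≤ n ×
    (∀ (R : Subset n) → ∣ R ∣ < m → ∀ u v → u ∉ R → v ∉ R → PathAvoiding R u v)

module Submission where

-- Let Δ be a flag (d-1)-pseudomanifold on Fin n, R a set of
-- fewer than 2d-2 vertices, u ∉ R and C the set of vertices reachable from u in
-- G(Δ) - R.  Flipping a facet τ at a ∈ τ replaces a by the other apex of the
-- ridge τ - a.  A facet is *good* if it meets C, or if it lies inside R and all
-- of its flips outside R lie in C.  Goodness passes across every ridge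
-- ('good-across-ridge') thanks to two ingredients:
--  * link parity: the link of a codimension-two face σ is a union of cycles, so
--    by the handshake lemma the link edges {s,q} with σ ∪ {s,q} meeting C are
--    even in number, and each link vertex s ∉ R lies on an even number of them;
--  * a pigeonhole choice: as |R| ≤ 2d-3, a ridge ρ ⊆ R has a vertex z such that
--    no vertex of R outside ρ is adjacent to all of ρ - z, which keeps R out of
--    the link of ρ - z (flagness turns "adjacent to all" into "forms a face").
-- By strong connectivity the facets through any v ∉ R are good, so v ∈ C.  The
-- bound n ≥ 2d-1 follows by deleting all vertices but a non-adjacent pair.

open import Defs
open import Data.Nat using (ℕ; zero; suc; _+_; _*_; _∸_; _≤_; _<_; z≤n; s≤s; _≤?_)
open import Data.Nat.Properties hiding (_≟_)
open import Data.Nat.Tactic.RingSolver using (solve-∀)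
open import Data.Bool using (Bool; true; false; _∧_; _∨_; not; T; if_then_else_; _xor_)
open import Data.Bool.Properties using (∧-comm; ∨-comm; ∧-zeroʳ; T-≡)
open import Data.Fin using (Fin; zero; suc; _≟_)
open import Data.Fin.Subset using (Subset; _∈_; _∉_; _⊆_; _∩_; _∪_; ∣_∣; ⁅_⁆)
open import Data.Vec using ([]; _∷_; lookup; tabulate)
open import Data.Vec.Properties using (lookup∘tabulate; tabulate∘lookup; []=⇒lookup; lookup⇒[]=; lookup-zipWith)
open import Data.Product
open import Data.Sum
open import Data.Empty
open import Function using (_∘_; Equivalence)
open import Relation.Nullary using (¬_; yes; no; does)
open import Relation.Binary.PropositionalEquality

eqb : ∀ {n} → Fin n → Fin n → Bool
eqb i j = does (i ≟ j)

eqb-refl : ∀ {n} (i : Fin n) → eqb i i ≡ true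
eqb-refl i with i ≟ i
... | yes _ = refl
... | no ¬p = ⊥-elim (¬p refl)

eqb-≡ : ∀ {n} {i j : Fin n} → eqb i j ≡ true → i ≡ j
eqb-≡ {i = i} {j} e with i ≟ j
... | yes p = p
eqb-≡ () | no _

eqb-≢ : ∀ {n} {i j : Fin n} → i ≢ j → eqb i j ≡ false
eqb-≢ {i = i} {j} ne with i ≟ j
... | yes p = ⊥-elim (ne p)
... | no _ = refl

eqb-false : ∀ {n} {i j : Fin n} → eqb i j ≡ false → i ≢ j
eqb-false {i = i} e refl with trans (sym (eqb-refl i)) e
... | ()

eqb-sym : ∀ {n} (i j : Fin n) → eqb i j ≡ eqb j i
eqb-sym i j with i ≟ j | j ≟ i
... | yes _ | yes _ = refl
... | no _ | no _ = refl
... | yes p | no q = ⊥-elim (q (sym p))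
... | no p | yes q = ⊥-elim (p (sym q))

eqb-disj : ∀ {n} {p q : Fin n} → p ≢ q → ∀ i → eqb i p ∧ eqb i q ≡ false
eqb-disj {p = p} {q} ne i with i ≟ p | i ≟ q
... | yes refl | yes refl = ⊥-elim (ne refl)
... | yes _ | no _ = refl
... | no _ | _ = refl

∧-l : ∀ {a b} → a ∧ b ≡ true → a ≡ true
∧-l {true} _ = refl
∧-r : ∀ {a b} → a ∧ b ≡ true → b ≡ true
∧-r {true} e = e
∧-i : ∀ {a b} → a ≡ true → b ≡ true → a ∧ b ≡ true
∧-i refl refl = refl
∨-l : ∀ {a} b → a ≡ true → a ∨ b ≡ true
∨-l b refl = refl
∨-r : ∀ a {b} → b ≡ true → a ∨ b ≡ true
∨-r true _ = refl
∨-r false e = e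
∨-e : ∀ {a b} → a ∨ b ≡ true → a ≡ true ⊎ b ≡ true
∨-e {true} _ = inj₁ refl
∨-e {false} e = inj₂ e
not-t : ∀ {a} → not a ≡ true → a ≡ false
not-t {false} _ = refl
not-i : ∀ {a} → a ≡ false → not a ≡ true
not-i refl = refl
t≢f : ∀ {a} → a ≡ true → a ≡ false → ⊥
t≢f refl ()
∨-false : ∀ {a b} → a ∨ b ≡ false → a ≡ false × b ≡ false
∨-false {false} e = refl , e
bdec : ∀ (a : Bool) → a ≡ true ⊎ a ≡ false
bdec true = inj₁ refl
bdec false = inj₂ refl

∧-swap : ∀ a b c → a ∧ (b ∧ c) ≡ b ∧ (a ∧ c)
∧-swap true b c = refl
∧-swap false true c = refl
∧-swap false false c = refl

∨-swap : ∀ a b c → (a ∨ b) ∨ c ≡ (a ∨ c) ∨ b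
∨-swap true b c = refl
∨-swap false true true = refl
∨-swap false true false = refl
∨-swap false false c with c
... | true = refl
... | false = refl

sumF : ∀ {n} → (Fin n → ℕ) → ℕ
sumF {zero} g = 0
sumF {suc n} g = g zero + sumF (g ∘ suc)

b2n : Bool → ℕ
b2n true = 1
b2n false = 0

cnt : ∀ {n} → (Fin n → Bool) → ℕ
cnt f = sumF (b2n ∘ f)

ite : Bool → ℕ → ℕ
ite b x = if b then x else 0

ite-true : ∀ {b x} → b ≡ true → ite b x ≡ x
ite-true refl = refl

ite-false : ∀ {a b x} → a ≡ false → b ≡ false → ite (a ∨ b) x ≡ 0
ite-false refl refl = refl

sumF-ext : ∀ {n} {g h : Fin n → ℕ} → (∀ i → g i ≡ h i) → sumF g ≡ sumF h
sumF-ext {zero} e = refl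
sumF-ext {suc n} e = cong₂ _+_ (e zero) (sumF-ext (e ∘ suc))

cnt-ext : ∀ {n} {f g : Fin n → Bool} → (∀ i → f i ≡ g i) → cnt f ≡ cnt g
cnt-ext e = sumF-ext (λ i → cong b2n (e i))

sumF-+ : ∀ {n} (g h : Fin n → ℕ) → sumF (λ i → g i + h i) ≡ sumF g + sumF h
sumF-+ {zero} g h = refl
sumF-+ {suc n} g h rewrite sumF-+ (g ∘ suc) (h ∘ suc) =
  interchange (g zero) (h zero) (sumF (g ∘ suc)) (sumF (h ∘ suc))
  where
  interchange : ∀ a b c d → (a + b) + (c + d) ≡ (a + c) + (b + d)
  interchange = solve-∀

sumF-mono : ∀ {n} {g h : Fin n → ℕ} → (∀ i → g i ≤ h i) → sumF g ≤ sumF h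
sumF-mono {zero} e = z≤n
sumF-mono {suc n} e = +-mono-≤ (e zero) (sumF-mono (e ∘ suc))

sumF-zero : ∀ {n} {g : Fin n → ℕ} → (∀ i → g i ≡ 0) → sumF g ≡ 0
sumF-zero {zero} e = refl
sumF-zero {suc n} e rewrite e zero = sumF-zero (e ∘ suc)

sumF-≥ : ∀ {n} (g : Fin n → ℕ) i → g i ≤ sumF g
sumF-≥ g zero = m≤m+n (g zero) _
sumF-≥ g (suc i) = ≤-trans (sumF-≥ (g ∘ suc) i) (m≤n+m _ (g zero))

sumF-ite1 : ∀ {n} (g : Fin n → ℕ) x → sumF (λ i → ite (eqb i x) (g i)) ≡ g x
sumF-ite1 {suc n} g zero = trans (cong (g zero +_) (sumF-zero {n} (λ _ → refl))) (+-identityʳ (g zero))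
sumF-ite1 {suc n} g (suc x) = sumF-ite1 (g ∘ suc) x

sumF-ite∨ : ∀ {n} (g : Fin n → ℕ) (S T : Fin n → Bool) → (∀ i → S i ∧ T i ≡ false) →
  sumF (λ i → ite (S i ∨ T i) (g i)) ≡ sumF (λ i → ite (S i) (g i)) + sumF (λ i → ite (T i) (g i))
sumF-ite∨ g S T disj = trans (sumF-ext (λ i → split (S i) (T i) (g i) (disj i)))
                             (sumF-+ (λ i → ite (S i) (g i)) (λ i → ite (T i) (g i)))
  where
  split : ∀ a b x → a ∧ b ≡ false → ite (a ∨ b) x ≡ ite a x + ite b x
  split true true x ()
  split true false x _ = sym (+-identityʳ x)
  split false b x _ = refl

sumF-const1 : ∀ {n} → sumF {n} (λ _ → 1) ≡ n
sumF-const1 {zero} = refl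
sumF-const1 {suc n} = cong suc (sumF-const1 {n})

cnt≤n : ∀ {n} (f : Fin n → Bool) → cnt f ≤ n
cnt≤n {n} f = subst (cnt f ≤_) (sumF-const1 {n}) (sumF-mono (λ i → b2n≤1 (f i)))
  where
  b2n≤1 : ∀ b → b2n b ≤ 1
  b2n≤1 true = s≤s z≤n
  b2n≤1 false = z≤n

cnt-mono : ∀ {n} {f g : Fin n → Bool} → (∀ i → f i ≡ true → g i ≡ true) → cnt f ≤ cnt g
cnt-mono h = sumF-mono (λ i → b2n-mono (h i))
  where
  b2n-mono : ∀ {a b} → (a ≡ true → b ≡ true) → b2n a ≤ b2n b
  b2n-mono {false} h = z≤n
  b2n-mono {true} h rewrite h refl = ≤-refl

cnt-pos : ∀ {n} (f : Fin n → Bool) i → f i ≡ true → 1 ≤ cnt f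
cnt-pos f i e = ≤-trans (subst (λ b → 1 ≤ b2n b) (sym e) ≤-refl) (sumF-≥ (b2n ∘ f) i)

cnt-zero : ∀ {n} {f : Fin n → Bool} → (∀ i → f i ≡ false) → cnt f ≡ 0
cnt-zero e = sumF-zero (λ i → cong b2n (e i))

search : ∀ {n} (f : Fin n → Bool) → (∃ λ i → f i ≡ true) ⊎ (∀ i → f i ≡ false)
search {zero} f = inj₂ (λ ())
search {suc n} f with bdec (f zero)
... | inj₁ e = inj₁ (zero , e)
... | inj₂ e with search (f ∘ suc)
...   | inj₁ (i , e') = inj₁ (suc i , e')
...   | inj₂ h = inj₂ λ { zero → e ; (suc i) → h i }

cnt-ie : ∀ {n} (f g : Fin n → Bool) → cnt f + cnt g ≡ cnt (λ i → f i ∨ g i) + cnt (λ i → f i ∧ g i)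
cnt-ie f g = begin
  cnt f + cnt g                                   ≡⟨ sym (sumF-+ (b2n ∘ f) (b2n ∘ g)) ⟩
  sumF (λ i → b2n (f i) + b2n (g i))              ≡⟨ sumF-ext (λ i → pointwise (f i) (g i)) ⟩
  sumF (λ i → b2n (f i ∨ g i) + b2n (f i ∧ g i))  ≡⟨ sumF-+ (λ i → b2n (f i ∨ g i)) (λ i → b2n (f i ∧ g i)) ⟩
  cnt (λ i → f i ∨ g i) + cnt (λ i → f i ∧ g i)   ∎
  where
  open ≡-Reasoning
  pointwise : ∀ a b → b2n a + b2n b ≡ b2n (a ∨ b) + b2n (a ∧ b)
  pointwise true true = refl
  pointwise true false = refl
  pointwise false true = refl
  pointwise false false = refl

cnt-split : ∀ {n} (f g : Fin n → Bool) → cnt f ≡ cnt (λ i → f i ∧ g i) + cnt (λ i → f i ∧ not (g i))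
cnt-split f g = trans (sumF-ext (λ i → pointwise (f i) (g i)))
                      (sumF-+ (λ i → b2n (f i ∧ g i)) (λ i → b2n (f i ∧ not (g i))))
  where
  pointwise : ∀ a b → b2n a ≡ b2n (a ∧ b) + b2n (a ∧ not b)
  pointwise true true = refl
  pointwise true false = refl
  pointwise false b = refl

cnt-single : ∀ {n} (x : Fin n) → cnt (λ i → eqb i x) ≡ 1
cnt-single x = trans (sumF-ext (λ i → pointwise (eqb i x))) (sumF-ite1 (λ _ → 1) x)
  where
  pointwise : ∀ b → b2n b ≡ ite b 1
  pointwise true = refl
  pointwise false = refl

add : ∀ {n} → (Fin n → Bool) → Fin n → Fin n → Bool
add f x i = f i ∨ eqb i x

del : ∀ {n} → (Fin n → Bool) → Fin n → Fin n → Bool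
del f x i = f i ∧ not (eqb i x)

cnt-remove : ∀ {n} (f : Fin n → Bool) x → f x ≡ true → cnt f ≡ suc (cnt (del f x))
cnt-remove f x e = trans (cnt-split f (λ i → eqb i x))
  (cong (_+ cnt (del f x)) (trans (cnt-ext only-x) (cnt-single x)))
  where
  only-x : ∀ i → f i ∧ eqb i x ≡ eqb i x
  only-x i with i ≟ x
  ... | yes refl rewrite e = refl
  ... | no _ = ∧-zeroʳ (f i)

cnt-add : ∀ {n} (f : Fin n → Bool) x → f x ≡ false → cnt (add f x) ≡ suc (cnt f)
cnt-add f x e = sym (begin
  suc (cnt f)                                    ≡⟨ +-comm 1 (cnt f) ⟩
  cnt f + 1                                      ≡⟨ cong (cnt f +_) (sym (cnt-single x)) ⟩
  cnt f + cnt (λ i → eqb i x)                    ≡⟨ cnt-ie f (λ i → eqb i x) ⟩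
  cnt (add f x) + cnt (λ i → f i ∧ eqb i x)      ≡⟨ cong (cnt (add f x) +_) (cnt-zero not-x) ⟩
  cnt (add f x) + 0                              ≡⟨ +-identityʳ _ ⟩
  cnt (add f x)                                  ∎)
  where
  open ≡-Reasoning
  not-x : ∀ i → f i ∧ eqb i x ≡ false
  not-x i with i ≟ x
  ... | yes refl rewrite e = refl
  ... | no _ = ∧-zeroʳ (f i)

cnt-strict : ∀ {n} {f g : Fin n → Bool} x → (∀ i → f i ≡ true → g i ≡ true) → g x ≡ true → f x ≡ false →
  suc (cnt f) ≤ cnt g
cnt-strict {f = f} {g} x h gx fx = subst (_≤ cnt g) (cnt-add f x fx) (cnt-mono sub)
  where
  sub : ∀ i → add f x i ≡ true → g i ≡ true
  sub i e with ∨-e e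
  ... | inj₁ e' = h i e'
  ... | inj₂ e' = subst (λ z → g z ≡ true) (sym (eqb-≡ e')) gx

cnt-eq : ∀ {n} {f g : Fin n → Bool} → (∀ i → f i ≡ true → g i ≡ true) → cnt g ≤ cnt f → ∀ i → g i ≡ f i
cnt-eq {f = f} {g} h le i with bdec (g i) | bdec (f i)
... | inj₁ gi | inj₁ fi = trans gi (sym fi)
... | inj₂ gi | inj₂ fi = trans gi (sym fi)
... | inj₂ gi | inj₁ fi = ⊥-elim (t≢f (h i fi) gi)
... | inj₁ gi | inj₂ fi = ⊥-elim (<⇒≱ (cnt-strict i h gi fi) le)

cnt-one : ∀ {n} (f : Fin n → Bool) → cnt f ≡ 1 → Σ (Fin n) λ x → f x ≡ true × (∀ y → f y ≡ true → y ≡ x)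
cnt-one f c with search f
... | inj₂ h = ⊥-elim (0≢1+n (trans (sym (cnt-zero h)) c))
... | inj₁ (x , fx) = x , fx , unique
  where
  unique : ∀ y → f y ≡ true → y ≡ x
  unique y fy with y ≟ x
  ... | yes p = p
  ... | no ne = ⊥-elim (1+n≰n (subst (1 ≤_) (suc-injective (trans (sym (cnt-remove f x fx)) c))
                  (cnt-pos (del f x) y (∧-i fy (not-i (eqb-≢ ne))))))

cnt-inj : ∀ {n} (f g : Fin n → Bool) (h : Fin n → Fin n) →
  (∀ i → f i ≡ true → g (h i) ≡ true) →
  (∀ i j → f i ≡ true → f j ≡ true → h i ≡ h j → i ≡ j) → cnt f ≤ cnt g
cnt-inj f g h = go (cnt f) f g refl
  where
  go : ∀ k (f g : Fin _ → Bool) → cnt f ≡ k →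
    (∀ i → f i ≡ true → g (h i) ≡ true) →
    (∀ i j → f i ≡ true → f j ≡ true → h i ≡ h j → i ≡ j) → cnt f ≤ cnt g
  go zero f g c _ _ = subst (_≤ cnt g) (sym c) z≤n
  go (suc k) f g c maps inj with search f
  ... | inj₂ z = ⊥-elim (0≢1+n (trans (sym (cnt-zero z)) c))
  ... | inj₁ (x , fx) =
    subst₂ _≤_ (sym (cnt-remove f x fx)) (sym (cnt-remove g (h x) (maps x fx)))
      (s≤s (go k (del f x) (del g (h x)) (suc-injective (trans (sym (cnt-remove f x fx)) c)) maps' inj'))
    where
    maps' : ∀ i → del f x i ≡ true → del g (h x) (h i) ≡ true
    maps' i e = ∧-i (maps i (∧-l e)) (not-i (eqb-≢ λ q → eqb-false (not-t (∧-r e)) (inj i x (∧-l e) fx q)))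
    inj' : ∀ i j → del f x i ≡ true → del f x j ≡ true → h i ≡ h j → i ≡ j
    inj' i j ei ej = inj i j (∧-l ei) (∧-l ej)

par : ℕ → Bool
par zero = false
par (suc n) = not (par n)

par-+ : ∀ a b → par (a + b) ≡ par a xor par b
par-+ zero b = refl
par-+ (suc a) b rewrite par-+ a b with par a | par b
... | true | true = refl
... | true | false = refl
... | false | true = refl
... | false | false = refl

par-ext : ∀ {n} {g h : Fin n → ℕ} → (∀ i → par (g i) ≡ par (h i)) → par (sumF g) ≡ par (sumF h)
par-ext {zero} e = refl
par-ext {suc n} {g} {h} e rewrite par-+ (g zero) (sumF (g ∘ suc)) | par-+ (h zero) (sumF (h ∘ suc))
  | e zero | par-ext {n} {g ∘ suc} {h ∘ suc} (e ∘ suc) = refl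

handshake : ∀ {n} (f : Fin n → Fin n → ℕ) → (∀ i j → f i j ≡ f j i) → (∀ i → f i i ≡ 0) →
  par (sumF (λ i → sumF (f i))) ≡ false
handshake {zero} f sy dg = refl
handshake {suc n} f sy dg = begin
  par (sumF (f zero) + sumF (λ i → sumF (f (suc i))))
    ≡⟨ cong (λ x → par (x + sumF (λ i → sumF (f (suc i))))) (cong (_+ A) (dg zero)) ⟩
  par (A + sumF (λ i → f (suc i) zero + sumF (f (suc i) ∘ suc)))
    ≡⟨ cong (λ x → par (A + x)) (sumF-+ (λ i → f (suc i) zero) (λ i → sumF (f (suc i) ∘ suc))) ⟩
  par (A + (sumF (λ i → f (suc i) zero) + B))
    ≡⟨ cong (λ x → par (A + (x + B))) (sumF-ext (λ i → sy (suc i) zero)) ⟩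
  par (A + (A + B))               ≡⟨ par-+ A (A + B) ⟩
  par A xor par (A + B)           ≡⟨ cong (par A xor_) (par-+ A B) ⟩
  par A xor (par A xor par B)     ≡⟨ xor-cancel (par A) (par B) ⟩
  par B                           ≡⟨ handshake (λ i j → f (suc i) (suc j)) (λ i j → sy (suc i) (suc j)) (dg ∘ suc) ⟩
  false                           ∎
  where
  open ≡-Reasoning
  A = sumF (f zero ∘ suc)
  B = sumF (λ i → sumF (f (suc i) ∘ suc))
  xor-cancel : ∀ a b → a xor (a xor b) ≡ b
  xor-cancel true true = refl
  xor-cancel true false = refl
  xor-cancel false b = refl

even-1+ : ∀ b → par (1 + b2n b) ≡ false → b ≡ true
even-1+ true _ = refl
even-1+ false ()

even-+1 : ∀ b → par (b2n b + 1) ≡ false → b ≡ true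
even-+1 true _ = refl
even-+1 false ()

par-restrict : ∀ {n} (g : Fin n → ℕ) (S : Fin n → Bool) → par (sumF g) ≡ false →
  (∀ i → S i ≡ false → par (g i) ≡ false) → par (sumF (λ i → ite (S i) (g i))) ≡ false
par-restrict g S p h = trans (par-ext same) p
  where
  same : ∀ i → par (ite (S i) (g i)) ≡ par (g i)
  same i with bdec (S i)
  ... | inj₁ e rewrite e = refl
  ... | inj₂ e rewrite e = sym (h i e)

-- The counting behind all pigeonhole steps: if k killers and m further
-- vertices fit into a set of size at most 2D - 3, and c + j = D candidates
-- remain with D + j ≤ m + 2, then there are fewer killers than candidates.
fewer-killers : ∀ k m c j D → k + m + 3 ≤ D + D → c + j ≡ D → D + j ≤ m + 2 → k < c
fewer-killers k m c j D le refl ge = +-cancelʳ-≤ (m + 2) (suc k) c (begin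
  suc k + (m + 2)      ≡⟨ shift k m ⟩
  k + m + 3            ≤⟨ le ⟩
  (c + j) + (c + j)    ≡⟨ regroup c j ⟩
  c + ((c + j) + j)    ≤⟨ +-monoʳ-≤ c ge ⟩
  c + (m + 2)          ∎)
  where
  open ≤-Reasoning
  shift : ∀ k m → suc k + (m + 2) ≡ k + m + 3
  shift = solve-∀
  regroup : ∀ c j → (c + j) + (c + j) ≡ c + ((c + j) + j)
  regroup = solve-∀

anyb : ∀ {n} → (Fin n → Bool) → Bool
anyb {zero} f = false
anyb {suc n} f = f zero ∨ anyb (f ∘ suc)

anyb-i : ∀ {n} (f : Fin n → Bool) i → f i ≡ true → anyb f ≡ true
anyb-i f zero e rewrite e = refl
anyb-i f (suc i) e = ∨-r (f zero) (anyb-i (f ∘ suc) i e)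

anyb-e : ∀ {n} (f : Fin n → Bool) → anyb f ≡ true → ∃ λ i → f i ≡ true
anyb-e {suc n} f e with ∨-e {f zero} e
... | inj₁ e' = zero , e'
... | inj₂ e' with anyb-e (f ∘ suc) e'
...   | i , e'' = suc i , e''

anyb-f : ∀ {n} (f : Fin n → Bool) → anyb f ≡ false → ∀ i → f i ≡ false
anyb-f f e i with bdec (f i)
... | inj₂ x = x
... | inj₁ x = ⊥-elim (t≢f (anyb-i f i x) e)

anyb-ext : ∀ {n} {f g : Fin n → Bool} → (∀ i → f i ≡ g i) → anyb f ≡ anyb g
anyb-ext {zero} e = refl
anyb-ext {suc n} e = cong₂ _∨_ (e zero) (anyb-ext (e ∘ suc))

allb : ∀ {n} → (Fin n → Bool) → Bool
allb f = not (anyb (λ i → not (f i)))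

allb-e : ∀ {n} (f : Fin n → Bool) → allb f ≡ true → ∀ i → f i ≡ true
allb-e f e i with bdec (f i)
... | inj₁ x = x
... | inj₂ x = ⊥-elim (t≢f (anyb-i (λ i → not (f i)) i (not-i x)) (not-t e))

allb-i : ∀ {n} (f : Fin n → Bool) → (∀ i → f i ≡ true) → allb f ≡ true
allb-i f h with bdec (anyb (λ i → not (f i)))
... | inj₂ e = not-i e
... | inj₁ e with anyb-e _ e
...   | i , x = ⊥-elim (t≢f (h i) (not-t x))

pick : ∀ {n} → (Fin n → Bool) → Fin n → Fin n
pick f d with search f
... | inj₁ (i , _) = i
... | inj₂ _ = d

pick-spec : ∀ {n} (f : Fin n → Bool) d → anyb f ≡ true → f (pick f d) ≡ true
pick-spec f d e with search f
... | inj₁ (i , fi) = fi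
... | inj₂ h with anyb-e f e
...   | i , fi = ⊥-elim (t≢f fi (h i))

pigeon : ∀ {n} (cand kil : Fin n → Bool) (K : Fin n → Fin n → Bool) →
  (∀ r z1 z2 → kil r ≡ true → cand z1 ≡ true → cand z2 ≡ true → K r z1 ≡ true → K r z2 ≡ true → z1 ≡ z2) →
  cnt kil < cnt cand → Σ (Fin n) λ z → cand z ≡ true × (∀ r → kil r ≡ true → K r z ≡ false)
pigeon cand kil K uq lt with search (λ z → cand z ∧ not (anyb (λ r → kil r ∧ K r z)))
... | inj₁ (z , e) = z , ∧-l e , λ r kr → unkilled r kr (anyb-f _ (not-t (∧-r e)) r)
  where
  unkilled : ∀ r → kil r ≡ true → kil r ∧ K r z ≡ false → K r z ≡ false
  unkilled r kr e' rewrite kr = e'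
... | inj₂ h = ⊥-elim (<⇒≱ lt (cnt-inj cand kil killer killer-kil killer-inj))
  where
  killed : ∀ z → cand z ≡ true → anyb (λ r → kil r ∧ K r z) ≡ true
  killed z cz with bdec (anyb (λ r → kil r ∧ K r z))
  ... | inj₁ x = x
  ... | inj₂ x = ⊥-elim (t≢f (∧-i cz (not-i x)) (h z))
  killer : Fin _ → Fin _
  killer z = pick (λ r → kil r ∧ K r z) z
  killer-spec : ∀ z → cand z ≡ true → kil (killer z) ∧ K (killer z) z ≡ true
  killer-spec z cz = pick-spec (λ r → kil r ∧ K r z) z (killed z cz)
  killer-kil : ∀ z → cand z ≡ true → kil (killer z) ≡ true
  killer-kil z cz = ∧-l (killer-spec z cz)
  killer-inj : ∀ z1 z2 → cand z1 ≡ true → cand z2 ≡ true → killer z1 ≡ killer z2 → z1 ≡ z2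
  killer-inj z1 z2 c1 c2 eq = uq (killer z1) z1 z2 (killer-kil z1 c1) c1 c2
    (∧-r (killer-spec z1 c1)) (subst (λ r → K r z2 ≡ true) (sym eq) (∧-r (killer-spec z2 c2)))

-- Boolean vertex sets versus Data.Fin.Subset: a subset p is read as the
-- predicate 'lookup p', a predicate f as the subset 'tabulate f'.
tab-cong : ∀ {n} {f g : Fin n → Bool} → (∀ i → f i ≡ g i) → tabulate f ≡ tabulate g
tab-cong {zero} e = refl
tab-cong {suc n} e = cong₂ _∷_ (e zero) (tab-cong (e ∘ suc))

lk-ext : ∀ {n} {p q : Subset n} → (∀ i → lookup p i ≡ lookup q i) → p ≡ q
lk-ext {p = p} {q} e = trans (sym (tabulate∘lookup p)) (trans (tab-cong e) (tabulate∘lookup q))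

lk-tab : ∀ {n} (f : Fin n → Bool) i → lookup (tabulate f) i ≡ f i
lk-tab f i = lookup∘tabulate f i

T→≡ : ∀ {b} → T b → b ≡ true
T→≡ = Equivalence.to T-≡
≡→T : ∀ {b} → b ≡ true → T b
≡→T = Equivalence.from T-≡

mem→ : ∀ {n} {i : Fin n} {p : Subset n} → i ∈ p → lookup p i ≡ true
mem→ = []=⇒lookup
→mem : ∀ {n} {i : Fin n} {p : Subset n} → lookup p i ≡ true → i ∈ p
→mem {i = i} {p} = lookup⇒[]= i p

∉→ : ∀ {n} {i : Fin n} {p : Subset n} → i ∉ p → lookup p i ≡ false
∉→ {i = i} {p} h with bdec (lookup p i)
... | inj₁ e = ⊥-elim (h (→mem e))
... | inj₂ e = e

→∉ : ∀ {n} {i : Fin n} {p : Subset n} → lookup p i ≡ false → i ∉ p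
→∉ e m = t≢f (mem→ m) e

⊆-∧ : ∀ {n} {ρ : Fin n → Bool} {σ : Subset n} → tabulate ρ ⊆ σ → ∀ i → lookup σ i ∧ ρ i ≡ ρ i
⊆-∧ {ρ = ρ} {σ} s i with bdec (ρ i)
... | inj₁ e rewrite e | mem→ (s (→mem (trans (lk-tab ρ i) e))) = refl
... | inj₂ e rewrite e = ∧-zeroʳ (lookup σ i)

lk-single : ∀ {n} (i k : Fin n) → lookup ⁅ i ⁆ k ≡ eqb k i
lk-single zero zero = refl
lk-single zero (suc k) = lk-empty k
  where
  lk-empty : ∀ {m} (k : Fin m) → lookup (Data.Fin.Subset.⊥ {m}) k ≡ false
  lk-empty zero = refl
  lk-empty (suc k) = lk-empty k
lk-single (suc i) zero = refl
lk-single (suc i) (suc k) = lk-single i k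

card : ∀ {n} (p : Subset n) → ∣ p ∣ ≡ cnt (lookup p)
card [] = refl
card (true ∷ p) = cong suc (card p)
card (false ∷ p) = card p

card∩ : ∀ {n} (p q : Subset n) → ∣ p ∩ q ∣ ≡ cnt (λ i → lookup p i ∧ lookup q i)
card∩ p q = trans (card (p ∩ q)) (cnt-ext (λ k → lookup-zipWith _∧_ k p q))

module Complex {n : ℕ} (Δ : SimplicialComplex n) where
  open SimplicialComplex Δ

  Fc : (Fin n → Bool) → Set
  Fc f = isFace (tabulate f) ≡ true

  Face→Fc : ∀ {p} → Face Δ p → Fc (lookup p)
  Face→Fc {p} h = subst (λ v → isFace v ≡ true) (sym (tabulate∘lookup p)) (T→≡ h)

  Fc-ext : ∀ {f g} → (∀ i → f i ≡ g i) → Fc f → Fc g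
  Fc-ext e h = subst (λ v → isFace v ≡ true) (tab-cong e) h

  Fc-down : ∀ {f g} → (∀ i → f i ≡ true → g i ≡ true) → Fc g → Fc f
  Fc-down {f} {g} sub h = T→≡ (downClosed {tabulate f} {tabulate g} sub' (≡→T h))
    where
    sub' : tabulate f ⊆ tabulate g
    sub' {x} m = →mem (trans (lk-tab g x) (sub x (trans (sym (lk-tab f x)) (mem→ m))))

  Fc-del : ∀ {τ} → Fc τ → ∀ a → Fc (del τ a)
  Fc-del Fτ a = Fc-down (λ i e → ∧-l e) Fτ

  pair : Fin n → Fin n → Fin n → Bool
  pair i j k = eqb k i ∨ eqb k j

  edgeB : Fin n → Fin n → Bool
  edgeB i j = not (eqb i j) ∧ isFace (tabulate (pair i j))

  pair-eq : ∀ i j → ⁅ i ⁆ ∪ ⁅ j ⁆ ≡ tabulate (pair i j)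
  pair-eq i j = lk-ext (λ k → trans (lookup-zipWith _∨_ k ⁅ i ⁆ ⁅ j ⁆)
    (trans (cong₂ _∨_ (lk-single i k) (lk-single j k)) (sym (lk-tab (pair i j) k))))

  edge→ : ∀ {i j} → Edge Δ i j → edgeB i j ≡ true
  edge→ {i} {j} (ne , h) = ∧-i (not-i (eqb-≢ ne)) (subst (λ v → isFace v ≡ true) (pair-eq i j) (T→≡ h))

  →edge : ∀ {i j} → edgeB i j ≡ true → Edge Δ i j
  →edge {i} {j} e = eqb-false (not-t (∧-l e)) ,
    ≡→T (subst (λ v → isFace v ≡ true) (sym (pair-eq i j)) (∧-r e))

  edge-sym : ∀ {i j} → edgeB i j ≡ true → edgeB j i ≡ true
  edge-sym {i} {j} e = ∧-i (not-i (trans (eqb-sym j i) (not-t (∧-l e))))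
    (Fc-ext (λ k → ∨-comm (eqb k i) (eqb k j)) (∧-r e))

  face-edge : ∀ {f} → Fc f → ∀ i j → f i ≡ true → f j ≡ true → i ≢ j → edgeB i j ≡ true
  face-edge {f} h i j fi fj ne = ∧-i (not-i (eqb-≢ ne)) (Fc-down sub h)
    where
    sub : ∀ k → pair i j k ≡ true → f k ≡ true
    sub k e with ∨-e {eqb k i} e
    ... | inj₁ x = subst (λ z → f z ≡ true) (sym (eqb-≡ x)) fi
    ... | inj₂ x = subst (λ z → f z ≡ true) (sym (eqb-≡ x)) fj

  adjExcept : (Fin n → Bool) → Fin n → Fin n → Bool
  adjExcept ρ r z = allb (λ w → not (ρ w) ∨ (eqb w z ∨ edgeB r w))

  adjExcept-i : ∀ {ρ r z} → (∀ w → ρ w ≡ true → w ≢ z → edgeB r w ≡ true) → adjExcept ρ r z ≡ true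
  adjExcept-i {ρ} {r} {z} h = allb-i _ each
    where
    each : ∀ w → not (ρ w) ∨ (eqb w z ∨ edgeB r w) ≡ true
    each w with bdec (ρ w) | w ≟ z
    ... | inj₂ e | _ rewrite e = refl
    ... | inj₁ e | yes _ = ∨-r (not (ρ w)) refl
    ... | inj₁ e | no wz = ∨-r (not (ρ w)) (h w e wz)

  adjExcept-e : ∀ {ρ r z} → adjExcept ρ r z ≡ true → ∀ w → ρ w ≡ true → w ≢ z → edgeB r w ≡ true
  adjExcept-e {ρ} {r} {z} k w ρw wz with allb-e _ k w
  ... | e rewrite ρw | eqb-≢ wz = e

  adjExcept-two : ∀ {ρ r z₁ z₂} → z₁ ≢ z₂ → adjExcept ρ r z₁ ≡ true → adjExcept ρ r z₂ ≡ true →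
    ∀ w → ρ w ≡ true → edgeB r w ≡ true
  adjExcept-two {ρ} {r} {z₁} {z₂} ne k₁ k₂ w ρw with w ≟ z₁
  ... | no wz₁ = adjExcept-e {ρ} {r} {z₁} k₁ w ρw wz₁
  ... | yes refl = adjExcept-e {ρ} {r} {z₂} k₂ w ρw ne

  link-adjExcept : ∀ {ρ z s} → del ρ z s ≡ false → Fc (add (del ρ z) s) → adjExcept ρ s z ≡ true
  link-adjExcept {ρ} {z} {s} σs Fs = adjExcept-i adj
    where
    adj : ∀ w → ρ w ≡ true → w ≢ z → edgeB s w ≡ true
    adj w ρw wz = face-edge Fs s w (∨-r (del ρ z s) (eqb-refl s)) (∨-l (eqb w s) σw)
                    (λ sw → t≢f (subst (λ v → del ρ z v ≡ true) (sym sw) σw) σs)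
      where
      σw : del ρ z w ≡ true
      σw = ∧-i ρw (not-i (eqb-≢ wz))

  quiet-vertex : ∀ {ρ} (kil : Fin n → Bool) → cnt kil < cnt ρ →
    (∀ r → kil r ≡ true → (∀ w → ρ w ≡ true → edgeB r w ≡ true) → ⊥) →
    Σ (Fin n) λ z → ρ z ≡ true × (∀ r → kil r ≡ true → adjExcept ρ r z ≡ false)
  quiet-vertex {ρ} kil lt no-cone = pigeon ρ kil (adjExcept ρ) at-most-one lt
    where
    at-most-one : ∀ r z₁ z₂ → kil r ≡ true → ρ z₁ ≡ true → ρ z₂ ≡ true →
      adjExcept ρ r z₁ ≡ true → adjExcept ρ r z₂ ≡ true → z₁ ≡ z₂
    at-most-one r z₁ z₂ kr _ _ k₁ k₂ with z₁ ≟ z₂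
    ... | yes e = e
    ... | no ne = ⊥-elim (no-cone r kr (adjExcept-two {ρ} {r} ne k₁ k₂))

  module Flag (fl : IsFlag Δ) where

    flagB : ∀ f → (∀ i j → f i ≡ true → f j ≡ true → i ≢ j → edgeB i j ≡ true) → Fc f
    flagB f h = T→≡ (fl (tabulate f) (λ i j mi mj ne → →edge (h i j (tr i mi) (tr j mj) ne)))
      where
      tr : ∀ i → i ∈ tabulate f → f i ≡ true
      tr i m = trans (sym (lk-tab f i)) (mem→ m)

    cone-face : ∀ {ρ} r → Fc ρ → (∀ w → ρ w ≡ true → edgeB r w ≡ true) → Fc (add ρ r)
    cone-face {ρ} r hρ adj = flagB (add ρ r) clique
      where
      clique : ∀ i j → add ρ r i ≡ true → add ρ r j ≡ true → i ≢ j → edgeB i j ≡ true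
      clique i j ei ej ne with ∨-e {ρ i} ei | ∨-e {ρ j} ej
      ... | inj₁ a | inj₁ b = face-edge hρ i j a b ne
      ... | inj₂ a | inj₁ b = subst (λ z → edgeB z j ≡ true) (sym (eqb-≡ a)) (adj j b)
      ... | inj₁ a | inj₂ b = edge-sym (subst (λ z → edgeB z i ≡ true) (sym (eqb-≡ b)) (adj i a))
      ... | inj₂ a | inj₂ b = ⊥-elim (ne (trans (eqb-≡ a) (sym (eqb-≡ b))))

one-extra : ∀ {n} (s t : Fin n → Bool) → cnt (λ i → s i ∧ t i) + 1 ≡ cnt s →
  Σ (Fin n) λ x → s x ≡ true × t x ≡ false × (∀ i → s i ≡ add (λ j → s j ∧ t j) x i)
one-extra s t c with cnt-one (λ i → s i ∧ not (t i)) one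
  where
  one : cnt (λ i → s i ∧ not (t i)) ≡ 1
  one = +-cancelˡ-≡ (cnt (λ i → s i ∧ t i)) _ _ (trans (sym (cnt-split s t)) (sym c))
... | x , ex , ux = x , ∧-l ex , not-t (∧-r ex) , pointwise
  where
  pointwise : ∀ i → s i ≡ add (λ j → s j ∧ t j) x i
  pointwise i with bdec (s i) | bdec (t i)
  ... | inj₁ si | inj₁ ti rewrite si | ti = refl
  ... | inj₁ si | inj₂ ti rewrite si | ti | ux i (∧-i si (not-i ti)) | eqb-refl x = refl
  ... | inj₂ si | _ rewrite si with i ≟ x
  ...   | yes refl = ⊥-elim (t≢f (∧-l ex) si)
  ...   | no ne = refl

del-add : ∀ {n} (ρ : Fin n → Bool) z → ρ z ≡ true → ∀ i → add (del ρ z) z i ≡ ρ i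
del-add ρ z ρz i with i ≟ z
... | yes refl rewrite ρz = refl
... | no _ with ρ i
...   | true = refl
...   | false = refl

add-del : ∀ {n} (ρ : Fin n → Bool) y → ρ y ≡ false → ∀ i → del (add ρ y) y i ≡ ρ i
add-del ρ y ρy i with i ≟ y
... | yes refl rewrite ρy = refl
... | no _ with ρ i
...   | true = refl
...   | false = refl

del-self : ∀ {n} (ρ : Fin n → Bool) z → del ρ z z ≡ false
del-self ρ z rewrite eqb-refl z = ∧-zeroʳ (ρ z)

del-other : ∀ {n} (ρ : Fin n → Bool) z i → i ≢ z → del ρ z i ≡ ρ i
del-other ρ z i ne rewrite eqb-≢ ne with ρ i
... | true = refl
... | false = refl

add-self : ∀ {n} (ρ : Fin n → Bool) z → add ρ z z ≡ true
add-self ρ z = ∨-r (ρ z) (eqb-refl z)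

add-del₂ˡ : ∀ {n} (τ : Fin n → Bool) p q → τ p ≡ true → p ≢ q → ∀ i → add (del (del τ p) q) p i ≡ del τ q i
add-del₂ˡ τ p q τp ne i with i ≟ p
... | yes refl rewrite eqb-≢ ne | τp = refl
... | no ip with i ≟ q
...   | yes refl with τ i
...     | true = refl
...     | false = refl
add-del₂ˡ τ p q τp ne i | no ip | no iq with τ i
...     | true = refl
...     | false = refl

add-del₂ʳ : ∀ {n} (τ : Fin n → Bool) p q → τ q ≡ true → p ≢ q → ∀ i → add (del (del τ p) q) q i ≡ del τ p i
add-del₂ʳ τ p q τq ne i with i ≟ q
... | yes refl rewrite eqb-≢ (λ e → ne (sym e)) | τq = refl
... | no iq with i ≟ p
...   | yes refl with τ i
...     | true = refl
...     | false = refl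
add-del₂ʳ τ p q τq ne i | no iq | no ip with τ i
...     | true = refl
...     | false = refl

add-del-comm : ∀ {n} (f : Fin n → Bool) a' a → a ≢ a' → ∀ i → add (del f a') a i ≡ del (add f a) a' i
add-del-comm f a' a ne i with i ≟ a'
... | yes refl rewrite eqb-≢ (λ e → ne (sym e)) with f i
...   | true = refl
...   | false = refl
add-del-comm f a' a ne i | no _ with f i | eqb i a
...   | true | _ = refl
...   | false | true = refl
...   | false | false = refl

del-size : ∀ {n} (ρ : Fin n → Bool) z k {m} → ρ z ≡ true → cnt ρ + k ≡ m → cnt (del ρ z) + suc k ≡ m
del-size ρ z k ρz c = trans (+-suc _ k) (trans (cong (_+ k) (sym (cnt-remove ρ z ρz))) c)

add-size : ∀ {n} (ρ : Fin n → Bool) s k {m} → ρ s ≡ false → cnt ρ + suc k ≡ m → cnt (add ρ s) + k ≡ m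
add-size ρ s k ρs c = trans (cong (_+ k) (cnt-add ρ s ρs)) (trans (sym (+-suc _ k)) c)

module Pseudomanifold {n : ℕ} (Δ : SimplicialComplex n) (d : ℕ) (pm : IsPseudomanifold Δ d) where
  open SimplicialComplex Δ
  open Complex Δ

  face-size : ∀ {f} → Fc f → cnt f ≤ d
  face-size {f} h = subst (_≤ d) (trans (card (tabulate f)) (cnt-ext (lk-tab f)))
    (proj₂ (proj₁ pm) (tabulate f) (≡→T h))

  full→Facet : ∀ {f} → Fc f → cnt f ≡ d → Facet Δ (tabulate f)
  full→Facet {f} h c = ≡→T h , λ τ fτ sub → lk-ext (λ i → trans (same sub fτ i) (sym (lk-tab f i)))
    where
    same : ∀ {τ} → tabulate f ⊆ τ → Face Δ τ → ∀ i → lookup τ i ≡ f i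
    same {τ} s fτ = cnt-eq (λ i e → mem→ (s (→mem (trans (lk-tab f i) e))))
                           (subst (cnt (lookup τ) ≤_) (sym c) (face-size (Face→Fc fτ)))

  -- adjacent facets have the same size, hence (by strong connectivity) all
  -- facets have as many vertices as the d-face σ₀ given by the dimension
  chain-size : ∀ {a b} → StrongChain Δ a b → ∣ a ∣ ≡ d → ∣ b ∣ ≡ d
  chain-size [ _ ] h = h
  chain-size ((_ , (ad1 , ad2)) ∷ rest) h = chain-size rest (trans (sym ad2) (trans ad1 h))

  σ₀ : Subset n
  σ₀ = proj₁ (proj₁ (proj₁ pm))

  σ₀-size : ∣ σ₀ ∣ ≡ d
  σ₀-size = proj₂ (proj₂ (proj₁ (proj₁ pm)))

  σ₀-facet : Facet Δ σ₀
  σ₀-facet = subst (Facet Δ) (tabulate∘lookup σ₀)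
    (full→Facet (Face→Fc (proj₁ (proj₂ (proj₁ (proj₁ pm))))) (trans (sym (card σ₀)) σ₀-size))

  facet-cnt : ∀ {σ} → Facet Δ σ → cnt (lookup σ) ≡ d
  facet-cnt {σ} fσ = trans (sym (card σ)) (chain-size (proj₁ (proj₂ pm) σ₀ σ σ₀-facet fσ) σ₀-size)

  maximal→Facet : ∀ {f} → Fc f → (∀ w → f w ≡ false → Fc (add f w) → ⊥) → Facet Δ (tabulate f)
  maximal→Facet {f} h none = ≡→T h , λ τ fτ sub → lk-ext (λ i → trans (same τ fτ sub i) (sym (lk-tab f i)))
    where
    same : ∀ τ → Face Δ τ → tabulate f ⊆ τ → ∀ i → lookup τ i ≡ f i
    same τ fτ sub i with bdec (f i)
    ... | inj₁ fi = trans (mem→ (sub (→mem (trans (lk-tab f i) fi)))) (sym fi)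
    ... | inj₂ fi with bdec (lookup τ i)
    ...   | inj₂ ti = trans ti (sym fi)
    ...   | inj₁ ti = ⊥-elim (none i fi (Fc-down below (Face→Fc fτ)))
      where
      below : ∀ j → add f i j ≡ true → lookup τ j ≡ true
      below j e with ∨-e {f j} e
      ... | inj₁ fj = mem→ (sub (→mem (trans (lk-tab f j) fj)))
      ... | inj₂ ji = subst (λ z → lookup τ z ≡ true) (sym (eqb-≡ ji)) ti

  extend : ∀ k f → Fc f → cnt f + k ≡ d → Σ (Subset n) λ σ → Facet Δ σ × (∀ i → f i ≡ true → lookup σ i ≡ true)
  extend zero f h c = tabulate f , full→Facet h (trans (sym (+-identityʳ (cnt f))) c) , λ i e → trans (lk-tab f i) e
  extend (suc k) f h c with search (λ w → not (f w) ∧ isFace (tabulate (add f w)))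
  ... | inj₁ (w , e) with extend k (add f w) (∧-r e)
         (trans (cong (_+ k) (cnt-add f w (not-t (∧-l e)))) (trans (sym (+-suc (cnt f) k)) c))
  ...   | σ , fσ , sub = σ , fσ , λ i e' → sub i (∨-l (eqb i w) e')
  extend (suc k) f h c | inj₂ none = ⊥-elim (m+1+n≢m d (trans (cong (_+ suc k) (sym size)) c))
    where
    size : cnt f ≡ d
    size = trans (cnt-ext (λ i → sym (lk-tab f i)))
      (facet-cnt (maximal→Facet h (λ w fw Fw → t≢f (∧-i (not-i fw) Fw) (none w))))

  facet-through : 1 ≤ d → ∀ u → Σ (Subset n) λ σ → Facet Δ σ × lookup σ u ≡ true
  facet-through 1≤d u with extend (d ∸ 1) (λ i → eqb i u) Fu (trans (cong (_+ (d ∸ 1)) (cnt-single u)) (m+[n∸m]≡n 1≤d))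
    where
    Fu : Fc (λ i → eqb i u)
    Fu = subst (λ v → isFace v ≡ true) (lk-ext (λ i → trans (lk-single u i) (sym (lk-tab (λ k → eqb k u) i))))
               (T→≡ (vertexFace u))
  ... | σ , fσ , sub = σ , fσ , sub u (eqb-refl u)

  facet-over-ridge : ∀ {ρ σ} → cnt ρ + 1 ≡ d → Facet Δ σ → tabulate ρ ⊆ σ →
    Σ (Fin n) λ x → ρ x ≡ false × (∀ i → lookup σ i ≡ add ρ x i)
  facet-over-ridge {ρ} {σ} cρ fσ s
    with one-extra (lookup σ) ρ (trans (cong (_+ 1) (cnt-ext (⊆-∧ s))) (trans cρ (sym (facet-cnt fσ))))
  ... | x , _ , ρx , pt = x , ρx , λ i → trans (pt i) (cong (_∨ eqb i x) (⊆-∧ s i))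

  record Apexes (ρ : Fin n → Bool) : Set where
    field
      ax ay : Fin n
      ax≢ay : ax ≢ ay
      ρax : ρ ax ≡ false
      ρay : ρ ay ≡ false
      Fx : Fc (add ρ ax)
      Fy : Fc (add ρ ay)
      only : ∀ q → ρ q ≡ false → Fc (add ρ q) → q ≡ ax ⊎ q ≡ ay

  apexes : ∀ ρ → Fc ρ → cnt ρ + 1 ≡ d → Apexes ρ
  apexes ρ hρ cρ with proj₂ (proj₂ pm) (tabulate ρ) (≡→T hρ) ridge-size
    where
    ridge-size : ∣ tabulate ρ ∣ ≡ d ∸ 1
    ridge-size = trans (trans (card (tabulate ρ)) (cnt-ext (lk-tab ρ)))
                       (trans (sym (m+n∸n≡m (cnt ρ) 1)) (cong (_∸ 1) cρ))
  ... | σ₁ , σ₂ , f₁ , f₂ , σ₁≢σ₂ , sub₁ , sub₂ , two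
    with facet-over-ridge cρ f₁ sub₁ | facet-over-ridge cρ f₂ sub₂
  ... | x , ρx , eqx | y , ρy , eqy = record
    { ax = x ; ay = y ; ax≢ay = x≢y ; ρax = ρx ; ρay = ρy
    ; Fx = Fc-ext eqx (Face→Fc (proj₁ f₁)) ; Fy = Fc-ext eqy (Face→Fc (proj₁ f₂)) ; only = only }
    where
    x≢y : x ≢ y
    x≢y e = σ₁≢σ₂ (lk-ext (λ i → trans (eqx i) (trans (cong (λ z → add ρ z i) e) (sym (eqy i)))))
    apex-of : ∀ {q z σ} → ρ q ≡ false → (∀ i → lookup σ i ≡ add ρ z i) → tabulate (add ρ q) ≡ σ → q ≡ z
    apex-of {q} {z} {σ} ρq eqσ e = eqb-≡ (subst (λ b → b ∨ eqb q z ≡ true) ρq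
      (trans (sym (eqσ q)) (trans (cong (λ v → lookup v q) (sym e)) (trans (lk-tab (add ρ q) q) (add-self ρ q)))))
    only : ∀ q → ρ q ≡ false → Fc (add ρ q) → q ≡ x ⊎ q ≡ y
    only q ρq h with two (tabulate (add ρ q)) (full→Facet h (trans (cnt-add ρ q ρq) (trans (+-comm 1 (cnt ρ)) cρ)))
                         (λ {i} m → →mem (trans (lk-tab (add ρ q) i) (∨-l (eqb i q) (trans (sym (lk-tab ρ i)) (mem→ m)))))
    ... | inj₁ e = inj₁ (apex-of ρq eqx e)
    ... | inj₂ e = inj₂ (apex-of ρq eqy e)

  apexOnly : ∀ ρ → Fc ρ → cnt ρ + 1 ≡ d → ∀ {x y} → x ≢ y → ρ x ≡ false → ρ y ≡ false →
    Fc (add ρ x) → Fc (add ρ y) → ∀ q → ρ q ≡ false → Fc (add ρ q) → q ≡ x ⊎ q ≡ y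
  apexOnly ρ hρ cρ {x} {y} ne ρx ρy fx fy q ρq fq = among (only q ρq fq) (only x ρx fx) (only y ρy fy) ne
    where
    open Apexes (apexes ρ hρ cρ)
    among : ∀ {q a b x y : Fin n} → (q ≡ a ⊎ q ≡ b) → (x ≡ a ⊎ x ≡ b) → (y ≡ a ⊎ y ≡ b) → x ≢ y → q ≡ x ⊎ q ≡ y
    among (inj₁ refl) (inj₁ refl) _ _ = inj₁ refl
    among (inj₂ refl) (inj₂ refl) _ _ = inj₁ refl
    among (inj₁ refl) (inj₂ refl) (inj₁ refl) _ = inj₂ refl
    among (inj₂ refl) (inj₁ refl) (inj₂ refl) _ = inj₂ refl
    among (inj₁ refl) (inj₂ refl) (inj₂ refl) ne = ⊥-elim (ne refl)
    among (inj₂ refl) (inj₁ refl) (inj₁ refl) ne = ⊥-elim (ne refl)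

  otherApex : ∀ ρ → Fc ρ → cnt ρ + 1 ≡ d → ∀ a → Σ (Fin n) λ b → b ≢ a × ρ b ≡ false × Fc (add ρ b)
  otherApex ρ hρ cρ a with Apexes.ax (apexes ρ hρ cρ) ≟ a
  ... | yes e = ay , (λ e' → ax≢ay (trans e (sym e'))) , ρay , Fy
    where open Apexes (apexes ρ hρ cρ)
  ... | no ne = ax , ne , ρax , Fx
    where open Apexes (apexes ρ hρ cρ)

  ridge-size : ∀ {τ : Fin n → Bool} {a} → cnt τ ≡ d → τ a ≡ true → cnt (del τ a) + 1 ≡ d
  ridge-size {τ} {a} cτ τa = del-size τ a 0 τa (trans (+-identityʳ _) cτ)

  flip : ∀ {τ} → Fc τ → cnt τ ≡ d → ∀ {a} → τ a ≡ true → Σ (Fin n) λ b → τ b ≡ false × Fc (add (del τ a) b)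
  flip {τ} Fτ cτ {a} τa with otherApex (del τ a) (Fc-del Fτ a) (ridge-size {τ} {a} cτ τa) a
  ... | b , b≢a , σb , Fb = b , trans (sym (del-other τ a b b≢a)) σb , Fb

  flip-unique : ∀ {τ a b b'} → Fc τ → cnt τ ≡ d → τ a ≡ true → τ b ≡ false → Fc (add (del τ a) b) →
    τ b' ≡ false → Fc (add (del τ a) b') → b' ≡ b
  flip-unique {τ} {a} {b} {b'} Fτ cτ τa τb Fb τb' Fb' =
    [ (λ e → ⊥-elim (t≢f τa (subst (λ z → τ z ≡ false) e τb'))) , (λ e → e) ]′
      (apexOnly (del τ a) (Fc-del Fτ a) (ridge-size {τ} {a} cτ τa) a≢b (del-self τ a) (outside τb)
                (Fc-ext (λ i → sym (del-add τ a τa i)) Fτ) Fb b' (outside τb') Fb')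
    where
    outside : ∀ {v} → τ v ≡ false → del τ a v ≡ false
    outside e rewrite e = refl
    a≢b : a ≢ b
    a≢b e = t≢f τa (subst (λ z → τ z ≡ false) (sym e) τb)

  -- in a flag complex the two apexes of a ridge are not adjacent (otherwise
  -- ρ ∪ {x, y} would be a face with d + 1 vertices)
  apexes-nonadjacent : IsFlag Δ → ∀ {ρ x y} → ρ x ≡ false → ρ y ≡ false → x ≢ y → cnt ρ + 1 ≡ d →
    Fc (add ρ x) → Fc (add ρ y) → ¬ (edgeB x y ≡ true)
  apexes-nonadjacent fl {ρ} {x} {y} ρx ρy x≢y cρ Fx Fy exy =
    1+n≰n (subst (_≤ d) (trans (cnt-add (add ρ x) y ρxy) (cong suc sizex)) (face-size (cone-face y Fx adj)))
    where
    open Flag fl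
    ρxy : add ρ x y ≡ false
    ρxy rewrite ρy = eqb-≢ (λ e → x≢y (sym e))
    sizex : cnt (add ρ x) ≡ d
    sizex = trans (cnt-add ρ x ρx) (trans (+-comm 1 (cnt ρ)) cρ)
    adj : ∀ w → add ρ x w ≡ true → edgeB y w ≡ true
    adj w e with ∨-e {ρ w} e
    ... | inj₁ ρw = face-edge Fy y w (add-self ρ y) (∨-l (eqb w y) ρw) (λ e' → t≢f ρw (subst (λ z → ρ z ≡ false) e' ρy))
    ... | inj₂ wx = subst (λ z → edgeB y z ≡ true) (sym (eqb-≡ wx)) (edge-sym exy)

  nonadjacent-pair : 1 ≤ d → IsFlag Δ → Σ (Fin n) λ a → Σ (Fin n) λ y → a ≢ y × ¬ Edge Δ a y
  nonadjacent-pair 1≤d fl with search (lookup σ₀)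
  ... | inj₂ none = ⊥-elim (<⇒≱ 1≤d (≤-reflexive (trans (sym (facet-cnt σ₀-facet)) (cnt-zero none))))
  ... | inj₁ (a , σ₀a) with flip Fσ₀ (facet-cnt σ₀-facet) σ₀a
    where
    Fσ₀ : Fc (lookup σ₀)
    Fσ₀ = Face→Fc (proj₁ σ₀-facet)
  ...   | y , σ₀y , Fy = a , y , a≢y , λ e → apexes-nonadjacent fl (del-self (lookup σ₀) a) ρy a≢y
            (ridge-size {lookup σ₀} {a} (facet-cnt σ₀-facet) σ₀a)
            (Fc-ext (λ i → sym (del-add (lookup σ₀) a σ₀a i)) (Face→Fc (proj₁ σ₀-facet))) Fy (edge→ e)
    where
    a≢y : a ≢ y
    a≢y e = t≢f σ₀a (subst (λ z → lookup σ₀ z ≡ false) (sym e) σ₀y)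
    ρy : del (lookup σ₀) a y ≡ false
    ρy = cong (_∧ not (eqb y a)) σ₀y

  record Adj (s t : Fin n → Bool) : Set where
    field
      x y : Fin n
      x≢y : x ≢ y
      ρx : s x ∧ t x ≡ false
      ρy : s y ∧ t y ≡ false
      Fρ : Fc (λ i → s i ∧ t i)
      cρ : cnt (λ i → s i ∧ t i) + 1 ≡ d
      eqs : ∀ i → s i ≡ add (λ j → s j ∧ t j) x i
      eqt : ∀ i → t i ≡ add (λ j → s j ∧ t j) y i

  adjUnpack : ∀ {σ τ} → Facet Δ σ → Facet Δ τ → Adjacent Δ σ τ → Adj (lookup σ) (lookup τ)
  adjUnpack {σ} {τ} fσ fτ (a1 , _)
    with one-extra s t (trans c1 (sym (facet-cnt fσ))) | one-extra t s c2
    where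
    s = lookup σ
    t = lookup τ
    c1 : cnt (λ i → s i ∧ t i) + 1 ≡ d
    c1 = trans (cong (_+ 1) (sym (card∩ σ τ))) (trans a1 (trans (card σ) (facet-cnt fσ)))
    c2 : cnt (λ i → t i ∧ s i) + 1 ≡ cnt t
    c2 = trans (cong (_+ 1) (cnt-ext (λ i → ∧-comm (t i) (s i)))) (trans c1 (sym (facet-cnt fτ)))
  ... | x , _ , tx , pts | y , ty , sy , ptt = record
    { x = x ; y = y ; x≢y = λ e → t≢f (subst (λ z → lookup τ z ≡ true) (sym e) ty) tx
    ; ρx = subst (λ b → lookup σ x ∧ b ≡ false) (sym tx) (∧-zeroʳ (lookup σ x))
    ; ρy = trans (∧-comm (lookup σ y) (lookup τ y)) (subst (λ b → lookup τ y ∧ b ≡ false) (sym sy) (∧-zeroʳ (lookup τ y)))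
    ; Fρ = Fc-down (λ i e → ∧-l e) (Face→Fc (proj₁ fσ))
    ; cρ = trans (cong (_+ 1) (sym (card∩ σ τ))) (trans a1 (trans (card σ) (facet-cnt fσ)))
    ; eqs = pts
    ; eqt = λ i → trans (ptt i) (cong (_∨ eqb i y) (∧-comm (lookup τ i) (lookup σ i))) }

module Propagation {n : ℕ} (Δ : SimplicialComplex n) (d : ℕ) (fl : IsFlag Δ) (pm : IsPseudomanifold Δ d)
  (R : Fin n → Bool) (hR : cnt R + 3 ≤ d + d) (C : Fin n → Bool)
  (C-notR : ∀ i → C i ≡ true → R i ≡ false)
  (C-closed : ∀ i j → C i ≡ true → Complex.edgeB Δ i j ≡ true → R j ≡ false → C j ≡ true) where
  open SimplicialComplex Δ
  open Complex Δ
  open Flag fl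
  open Pseudomanifold Δ d pm

  meetsC : (Fin n → Bool) → Bool
  meetsC f = anyb (λ i → f i ∧ C i)

  InR : (Fin n → Bool) → Set
  InR f = ∀ i → f i ≡ true → R i ≡ true

  meetsC-ext : ∀ {f g} → (∀ i → f i ≡ g i) → meetsC f ≡ meetsC g
  meetsC-ext e = anyb-ext (λ i → cong (_∧ C _) (e i))

  meetsC-at : ∀ {f} i → f i ≡ true → C i ≡ true → meetsC f ≡ true
  meetsC-at {f} i fi ci = anyb-i (λ i → f i ∧ C i) i (∧-i fi ci)

  meetsC-e : ∀ {f} → meetsC f ≡ true → Σ (Fin n) λ i → f i ≡ true × C i ≡ true
  meetsC-e {f} e with anyb-e _ e
  ... | i , x = i , ∧-l x , ∧-r x

  R→notC : ∀ i → R i ≡ true → C i ≡ false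
  R→notC i r with bdec (C i)
  ... | inj₁ c = ⊥-elim (t≢f r (C-notR i c))
  ... | inj₂ c = c

  meetsC-R : ∀ {f} → InR f → meetsC f ≡ false
  meetsC-R {f} h with bdec (meetsC f)
  ... | inj₂ x = x
  ... | inj₁ x with meetsC-e {f} x
  ...   | i , fi , ci = ⊥-elim (t≢f ci (R→notC i (h i fi)))

  meetsC-apex : ∀ {ρ} b → InR ρ → meetsC (add ρ b) ≡ C b
  meetsC-apex {ρ} b h with bdec (C b)
  ... | inj₁ cb = trans (meetsC-at {add ρ b} b (∨-r (ρ b) (eqb-refl b)) cb) (sym cb)
  ... | inj₂ cb with bdec (meetsC (add ρ b))
  ...   | inj₂ x = trans x (sym cb)
  ...   | inj₁ x with meetsC-e {add ρ b} x
  ...     | i , fi , ci with ∨-e {ρ i} fi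
  ...       | inj₁ r = ⊥-elim (t≢f ci (R→notC i (h i r)))
  ...       | inj₂ e = ⊥-elim (t≢f (subst (λ z → C z ≡ true) (eqb-≡ e) ci) cb)

  -- The total degree is even (handshake) and every link
  -- vertex s ∉ R has even degree, so the degrees of the link vertices in R sum
  -- to an even number ('restricted-even').
  module LinkParity (σ : Fin n → Bool) (cσ : cnt σ + 2 ≡ d) (Rσ : InR σ) where

    linkGood : Fin n → Fin n → Bool
    linkGood s q = isFace (tabulate (add (add σ s) q)) ∧ meetsC (add (add σ s) q)

    linkEdge : Fin n → Fin n → ℕ
    linkEdge s q = b2n (not (σ s) ∧ (not (σ q) ∧ (not (eqb s q) ∧ linkGood s q)))

    degree : Fin n → ℕ
    degree s = sumF (linkEdge s)

    -- link edges are symmetric and loop-free, so the total degree is even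
    linkGood-sym : ∀ s q → linkGood s q ≡ linkGood q s
    linkGood-sym s q = cong₂ _∧_ (cong isFace (tab-cong sw)) (meetsC-ext sw)
      where
      sw : ∀ i → add (add σ s) q i ≡ add (add σ q) s i
      sw i = ∨-swap (σ i) (eqb i s) (eqb i q)

    linkEdge-sym : ∀ s q → linkEdge s q ≡ linkEdge q s
    linkEdge-sym s q = cong b2n (trans (∧-swap (not (σ s)) (not (σ q)) _)
      (cong (λ z → not (σ q) ∧ (not (σ s) ∧ z)) (cong₂ _∧_ (cong not (eqb-sym s q)) (linkGood-sym s q))))

    linkEdge-diag : ∀ s → linkEdge s s ≡ 0
    linkEdge-diag s rewrite eqb-refl s with σ s
    ... | true = refl
    ... | false = refl

    total-even : par (sumF degree) ≡ false
    total-even = handshake linkEdge linkEdge-sym linkEdge-diag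

    link-ridge-size : ∀ s → σ s ≡ false → cnt (add σ s) + 1 ≡ d
    link-ridge-size s e = add-size σ s 1 e cσ

    linkEdge-inside : ∀ s q → σ s ≡ false → add σ s q ≡ true → linkEdge s q ≡ 0
    linkEdge-inside s q σs ρq rewrite σs with ∨-e {σ q} ρq
    ... | inj₁ sq rewrite sq = refl
    ... | inj₂ eq = subst (λ z → b2n (not (σ q) ∧ (not z ∧ linkGood s q)) ≡ 0) (sym (trans (eqb-sym s q) eq)) (no-edge (σ q))
      where
      no-edge : ∀ b → b2n (not b ∧ false) ≡ 0
      no-edge true = refl
      no-edge false = refl

    linkEdge-outside : ∀ s q → σ s ≡ false → add σ s q ≡ false → linkEdge s q ≡ b2n (linkGood s q)
    linkEdge-outside s q σs ρq
      rewrite σs | proj₁ (∨-false {σ q} ρq) | trans (eqb-sym s q) (proj₂ (∨-false {σ q} ρq)) = refl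

    degree-ridge : ∀ s → σ s ≡ false → ∀ {x y} → x ≢ y → add σ s x ≡ false → add σ s y ≡ false →
      Fc (add (add σ s) x) → Fc (add (add σ s) y) →
      degree s ≡ b2n (meetsC (add (add σ s) x)) + b2n (meetsC (add (add σ s) y))
    degree-ridge s σs {x} {y} ne ρx ρy fx fy =
      trans (sumF-ext pointwise) (trans (sumF-ite∨ g (λ q → eqb q x) (λ q → eqb q y) (eqb-disj ne))
        (cong₂ _+_ (sumF-ite1 g x) (sumF-ite1 g y)))
      where
      ρ : Fin n → Bool
      ρ = add σ s
      g : Fin n → ℕ
      g q = b2n (meetsC (add ρ q))
      apex-or-not : ∀ q → ρ q ≡ false → b2n (linkGood s q) ≡ ite (eqb q x ∨ eqb q y) (g q)
      apex-or-not q ρq with bdec (isFace (tabulate (add ρ q)))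
      ... | inj₁ fq = trans (cong (λ b → b2n (b ∧ meetsC (add ρ q))) fq) (sym (ite-true (apex only)))
        where
        only : q ≡ x ⊎ q ≡ y
        only = apexOnly ρ (Fc-down (λ i e → ∨-l (eqb i x) e) fx) (link-ridge-size s σs) ne ρx ρy fx fy q ρq fq
        apex : q ≡ x ⊎ q ≡ y → eqb q x ∨ eqb q y ≡ true
        apex (inj₁ refl) = ∨-l (eqb q y) (eqb-refl q)
        apex (inj₂ refl) = ∨-r (eqb q x) (eqb-refl q)
      ... | inj₂ nf = trans (cong (λ b → b2n (b ∧ meetsC (add ρ q))) nf) (sym (ite-false
            (eqb-≢ (λ e → t≢f (subst (λ z → Fc (add ρ z)) (sym e) fx) nf))
            (eqb-≢ (λ e → t≢f (subst (λ z → Fc (add ρ z)) (sym e) fy) nf))))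
      pointwise : ∀ q → linkEdge s q ≡ ite (eqb q x ∨ eqb q y) (g q)
      pointwise q with bdec (ρ q)
      ... | inj₁ ρq = trans (linkEdge-inside s q σs ρq) (sym (ite-false
            (eqb-≢ (λ e → t≢f ρq (subst (λ z → ρ z ≡ false) (sym e) ρx)))
            (eqb-≢ (λ e → t≢f ρq (subst (λ z → ρ z ≡ false) (sym e) ρy)))))
      ... | inj₂ ρq = trans (linkEdge-outside s q σs ρq) (apex-or-not q ρq)

    -- for s ∉ R ∪ C, no facet through σ ∪ {s} meets C: its C-vertex would be
    -- joined to s
    outside-C : ∀ s → σ s ≡ false → R s ≡ false → C s ≡ false → ∀ b → add σ s b ≡ false →
      Fc (add (add σ s) b) → meetsC (add (add σ s) b) ≡ false
    outside-C s σs rs cs b ρb fb with bdec (meetsC (add (add σ s) b))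
    ... | inj₂ x = x
    ... | inj₁ x with meetsC-e {add (add σ s) b} x
    ...   | i , fi , ci with ∨-e {add σ s i} fi
    ...     | inj₂ e = ⊥-elim (t≢f (C-closed b s (subst (λ z → C z ≡ true) (eqb-≡ e) ci)
                 (face-edge fb b s (add-self (add σ s) b) (∨-l (eqb s b) (add-self σ s))
                    (λ e' → t≢f (subst (λ z → add σ s z ≡ true) (sym e') (add-self σ s)) ρb)) rs) cs)
    ...     | inj₁ ρi with ∨-e {σ i} ρi
    ...       | inj₁ si = ⊥-elim (t≢f ci (R→notC i (Rσ i si)))
    ...       | inj₂ e = ⊥-elim (t≢f (subst (λ z → C z ≡ true) (eqb-≡ e) ci) cs)

    -- a link vertex s ∉ R has even degree: 2 if s ∈ C, 0 otherwise
    degree-even : ∀ s → σ s ≡ false → R s ≡ false → Fc (add σ s) → par (degree s) ≡ false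
    degree-even s σs rs fs = subst (λ k → par k ≡ false) (sym (degree-ridge s σs ax≢ay ρax ρay Fx Fy)) (by-C (bdec (C s)))
      where
      open Apexes (apexes (add σ s) fs (link-ridge-size s σs))
      by-C : C s ≡ true ⊎ C s ≡ false →
        par (b2n (meetsC (add (add σ s) ax)) + b2n (meetsC (add (add σ s) ay))) ≡ false
      by-C (inj₁ cs) rewrite meetsC-at {add (add σ s) ax} s (∨-l (eqb s ax) (add-self σ s)) cs
                           | meetsC-at {add (add σ s) ay} s (∨-l (eqb s ay) (add-self σ s)) cs = refl
      by-C (inj₂ cs) rewrite outside-C s σs rs cs ax ρax Fx | outside-C s σs rs cs ay ρay Fy = refl

    -- the degrees over any Sp containing all R-vertices of the link sum to an
    -- even number (vertices outside the link have degree 0)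
    restricted-even : (Sp : Fin n → Bool) → (∀ s → R s ≡ true → σ s ≡ false → Fc (add σ s) → Sp s ≡ true) →
      par (sumF (λ s → ite (Sp s) (degree s))) ≡ false
    restricted-even Sp H = par-restrict degree Sp total-even dropped
      where
      no-edges : ∀ s → (∀ q → linkEdge s q ≡ 0) → par (degree s) ≡ false
      no-edges s h = subst (λ k → par k ≡ false) (sym (sumF-zero h)) refl
      dropped : ∀ s → Sp s ≡ false → par (degree s) ≡ false
      dropped s sp with bdec (σ s)
      ... | inj₁ σs = no-edges s (λ q → subst (λ b → b2n (not b ∧ (not (σ q) ∧ (not (eqb s q) ∧ linkGood s q))) ≡ 0) (sym σs) refl)
      ... | inj₂ σs with bdec (isFace (tabulate (add σ s)))
      ...   | inj₂ nf = no-edges s not-link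
        where
        not-link : ∀ q → linkEdge s q ≡ 0
        not-link q with bdec (isFace (tabulate (add (add σ s) q)))
        ... | inj₁ fq = ⊥-elim (t≢f (Fc-down (λ i e → ∨-l (eqb i q) e) fq) nf)
        ... | inj₂ fq rewrite fq = zero-at (not (σ s)) (not (σ q)) (not (eqb s q))
          where
          zero-at : ∀ a b c → b2n (a ∧ (b ∧ (c ∧ false))) ≡ 0
          zero-at false b c = refl
          zero-at true false c = refl
          zero-at true true false = refl
          zero-at true true true = refl
      ...   | inj₁ fs with bdec (R s)
      ...     | inj₁ rs = ⊥-elim (t≢f (H s rs σs fs) sp)
      ...     | inj₂ rs = degree-even s σs rs fs

    degree-facet : ∀ s a b τ → σ s ≡ false → (∀ i → add σ s i ≡ del τ a i) → Fc τ → InR τ →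
      τ a ≡ true → τ b ≡ false → Fc (add (del τ a) b) → degree s ≡ b2n (C b)
    degree-facet s a b τ σs eq Fτ Rτ τa τb Fb =
      trans (degree-ridge s σs a≢b (trans (eq a) (del-self τ a)) (trans (eq b) τ-a-b)
                (Fc-ext (λ i → trans (sym (del-add τ a τa i)) (cong (_∨ eqb i a) (sym (eq i)))) Fτ)
                (Fc-ext (λ i → cong (_∨ eqb i b) (sym (eq i))) Fb))
        (cong₂ _+_ (cong b2n (trans (meetsC-ext (λ i → trans (cong (_∨ eqb i a) (eq i)) (del-add τ a τa i))) (meetsC-R Rτ)))
                   (cong b2n (trans (meetsC-ext (λ i → cong (_∨ eqb i b) (eq i))) (meetsC-apex b (λ i e → Rτ i (∧-l e))))))
      where
      a≢b : a ≢ b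
      a≢b e = t≢f τa (subst (λ z → τ z ≡ false) (sym e) τb)
      τ-a-b : del τ a b ≡ false
      τ-a-b rewrite τb = refl

  InR-of : ∀ ρ → (∀ i → ρ i ∧ not (R i) ≡ false) → InR ρ
  InR-of ρ h i e with bdec (R i)
  ... | inj₁ r = r
  ... | inj₂ r = ⊥-elim (t≢f (∧-i e (not-i r)) (h i))

  R-split : ∀ ρ → InR ρ → cnt R ≡ cnt (λ r → R r ∧ not (ρ r)) + cnt ρ
  R-split ρ h = trans (cnt-split R ρ)
    (trans (+-comm (cnt (λ i → R i ∧ ρ i)) (cnt (λ i → R i ∧ not (ρ i)))) (cong (cnt (λ r → R r ∧ not (ρ r)) +_) (cnt-ext inside)))
    where
    inside : ∀ i → R i ∧ ρ i ≡ ρ i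
    inside i with bdec (ρ i)
    ... | inj₁ e rewrite e | h i e = refl
    ... | inj₂ e rewrite e = ∧-zeroʳ (R i)

  -- The case ρ ⊆ R of 'meets-across' below: then x ∈ C, y ∉ R, and link parity
  -- at ρ - z, for a quiet vertex z of ρ, shows that ρ ∪ {y} meets C.
  meets-across-R : ∀ {ρ x y} → Fc ρ → cnt ρ + 1 ≡ d → x ≢ y → ρ x ≡ false → ρ y ≡ false →
    Fc (add ρ x) → Fc (add ρ y) → InR ρ → C x ≡ true → R y ≡ false → meetsC (add ρ y) ≡ true
  meets-across-R {ρ} {x} {y} Fρ cρ ne ρx ρy Fx Fy Rρ Cx Ry = at-quiet (quiet-vertex kil fewer no-cone)
    where
    kil : Fin n → Bool
    kil r = R r ∧ not (ρ r)
    fewer : cnt kil < cnt ρ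
    fewer = fewer-killers (cnt kil) (cnt ρ) (cnt ρ) 1 d (subst (λ k → k + 3 ≤ d + d) (R-split ρ Rρ) hR) cρ
              (≤-reflexive (trans (cong (_+ 1) (sym cρ)) (+-assoc (cnt ρ) 1 1)))
    -- a killer adjacent to all of ρ would be a third apex of ρ
    no-cone : ∀ r → kil r ≡ true → (∀ w → ρ w ≡ true → edgeB r w ≡ true) → ⊥
    no-cone r kr adj = [ (λ e → t≢f (∧-l kr) (subst (λ z → R z ≡ false) (sym e) (C-notR x Cx)))
                       , (λ e → t≢f (∧-l kr) (subst (λ z → R z ≡ false) (sym e) Ry)) ]′
                       (apexOnly ρ Fρ cρ ne ρx ρy Fx Fy r (not-t (∧-r kr)) (cone-face r Fρ adj))
    at-quiet : (Σ (Fin n) λ z → ρ z ≡ true × (∀ r → kil r ≡ true → adjExcept ρ r z ≡ false)) →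
      meetsC (add ρ y) ≡ true
    at-quiet (z , ρz , quiet) = even-1+ _ (subst (λ k → par k ≡ false) degree-z even-z)
      where
      σ : Fin n → Bool
      σ = del ρ z
      open LinkParity σ (del-size ρ z 1 ρz cρ) (λ i e → Rρ i (∧-l e))
      only-z : ∀ s → R s ≡ true → σ s ≡ false → Fc (add σ s) → eqb s z ≡ true
      only-z s rs σs fs with bdec (ρ s)
      ... | inj₁ ρs with bdec (eqb s z)
      ...   | inj₁ e = e
      ...   | inj₂ e = ⊥-elim (t≢f (∧-i ρs (not-i e)) σs)
      only-z s rs σs fs | inj₂ ρs = ⊥-elim (t≢f (link-adjExcept {ρ} {z} {s} σs fs) (quiet s (∧-i rs (not-i ρs))))
      even-z : par (degree z) ≡ false
      even-z = subst (λ k → par k ≡ false) (sumF-ite1 degree z) (restricted-even (λ s → eqb s z) only-z)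
      back : ∀ i → add σ z i ≡ ρ i
      back = del-add ρ z ρz
      degree-z : degree z ≡ 1 + b2n (meetsC (add ρ y))
      degree-z = trans
        (degree-ridge z (del-self ρ z) ne (trans (back x) ρx) (trans (back y) ρy)
          (Fc-ext (λ i → cong (_∨ eqb i x) (sym (back i))) Fx) (Fc-ext (λ i → cong (_∨ eqb i y) (sym (back i))) Fy))
        (cong₂ _+_ (cong b2n (trans (meetsC-ext (λ i → cong (_∨ eqb i x) (back i))) (meetsC-at {add ρ x} x (add-self ρ x) Cx)))
                   (cong b2n (meetsC-ext (λ i → cong (_∨ eqb i y) (back i)))))

  -- If ρ itself has a vertex w ∉ R,
  -- w is joined to the C-vertex of ρ ∪ {x}; otherwise use 'meets-across-R'.
  meets-across : ∀ {ρ x y} → Fc ρ → cnt ρ + 1 ≡ d → x ≢ y → ρ x ≡ false → ρ y ≡ false →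
    Fc (add ρ x) → Fc (add ρ y) → meetsC (add ρ x) ≡ true →
    (Σ (Fin n) λ w → add ρ y w ≡ true × R w ≡ false) → meetsC (add ρ y) ≡ true
  meets-across {ρ} {x} {y} Fρ cρ ne ρx ρy Fx Fy mF (w₀ , yw₀ , Rw₀) with search (λ w → ρ w ∧ not (R w))
  ... | inj₁ (w , e) with meetsC-e {add ρ x} mF
  ...   | c , xc , Cc with c ≟ w
  ...     | yes refl = meetsC-at {add ρ y} c (∨-l (eqb c y) (∧-l e)) Cc
  ...     | no cw = meetsC-at {add ρ y} w (∨-l (eqb w y) (∧-l e))
                 (C-closed c w Cc (face-edge Fx c w xc (∨-l (eqb w x) (∧-l e)) cw) (not-t (∧-r e)))
  meets-across {ρ} {x} {y} Fρ cρ ne ρx ρy Fx Fy mF (w₀ , yw₀ , Rw₀) | inj₂ none =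
    meets-across-R Fρ cρ ne ρx ρy Fx Fy Rρ x∈C y∉R
    where
    Rρ : InR ρ
    Rρ = InR-of ρ none
    x∈C : C x ≡ true
    x∈C with meetsC-e {add ρ x} mF
    ... | c , xc , Cc with ∨-e {ρ c} xc
    ...   | inj₁ ρc = ⊥-elim (t≢f Cc (R→notC c (Rρ c ρc)))
    ...   | inj₂ e = subst (λ z → C z ≡ true) (eqb-≡ e) Cc
    y∉R : R y ≡ false
    y∉R with ∨-e {ρ w₀} yw₀
    ... | inj₁ ρw = ⊥-elim (t≢f (Rρ w₀ ρw) Rw₀)
    ... | inj₂ e = subst (λ z → R z ≡ false) (eqb-≡ e) Rw₀

  -- Link parity at σ = τ - {p, q} for a facet τ ⊆ R, when no vertex of R
  -- outside τ is adjacent to all of σ (so p, q are the only R-vertices of the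
  -- link): if the flip of τ at p lies in C, so does the flip at q.
  flip-transfer : ∀ {τ p q bp bq} → Fc τ → cnt τ ≡ d → InR τ → p ≢ q → τ p ≡ true → τ q ≡ true →
    (∀ r → R r ≡ true → τ r ≡ false → adjExcept (del τ p) r q ≡ false) →
    τ bp ≡ false → Fc (add (del τ p) bp) → C bp ≡ true →
    τ bq ≡ false → Fc (add (del τ q) bq) → C bq ≡ true
  flip-transfer {τ} {p} {q} {bp} {bq} Fτ cτ Rτ ne τp τq quiet τbp Fbp Cbp τbq Fbq =
    even-+1 _ (subst (λ k → par k ≡ false) sum-pq (restricted-even (λ s → eqb s p ∨ eqb s q) only-pq))
    where
    σ : Fin n → Bool
    σ = del (del τ p) q
    τ-p-q : del τ p q ≡ true
    τ-p-q = trans (del-other τ p q (λ e → ne (sym e))) τq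
    open LinkParity σ (del-size (del τ p) q 1 τ-p-q (ridge-size {τ} {p} cτ τp))
                      (λ i e → Rτ i (∧-l (∧-l e)))
    only-pq : ∀ s → R s ≡ true → σ s ≡ false → Fc (add σ s) → eqb s p ∨ eqb s q ≡ true
    only-pq s rs σs fs with bdec (τ s)
    ... | inj₁ τs with bdec (eqb s p)
    ...   | inj₁ e rewrite e = refl
    ...   | inj₂ e with bdec (eqb s q)
    ...     | inj₁ e' rewrite e' = ∨-r (eqb s p) refl
    ...     | inj₂ e' = ⊥-elim (t≢f (∧-i (∧-i τs (not-i e)) (not-i e')) σs)
    only-pq s rs σs fs | inj₂ τs = ⊥-elim (t≢f (link-adjExcept {del τ p} {q} {s} σs fs) (quiet s rs τs))
    sum-pq : sumF (λ s → ite (eqb s p ∨ eqb s q) (degree s)) ≡ b2n (C bq) + 1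
    sum-pq = trans (sumF-ite∨ degree (λ s → eqb s p) (λ s → eqb s q) (eqb-disj ne))
      (cong₂ _+_
        (trans (sumF-ite1 degree p)
          (degree-facet p q bq τ (trans (del-other (del τ p) q p ne) (del-self τ p)) (add-del₂ˡ τ p q τp ne) Fτ Rτ τq τbq Fbq))
        (trans (sumF-ite1 degree q)
          (trans (degree-facet q p bp τ (del-self (del τ p) q) (add-del₂ʳ τ p q τq ne) Fτ Rτ τp τbp Fbp) (cong b2n Cbp))))

  Guarded : (Fin n → Bool) → Set
  Guarded τ = ∀ a y → τ a ≡ true → τ y ≡ false → Fc (add (del τ a) y) → R y ≡ false → C y ≡ true

  module KillerFacts {τ : Fin n → Bool} (Fτ : Fc τ) (cτ : cnt τ ≡ d) (r : Fin n) (kr : R r ∧ not (τ r) ≡ true) where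

    -- r cannot be adjacent to all of τ - a when the flip of τ at a is outside R:
    -- r would be a second flip
    no-cone : ∀ {a b} → τ a ≡ true → τ b ≡ false → Fc (add (del τ a) b) → R b ≡ false →
      (∀ w → del τ a w ≡ true → edgeB r w ≡ true) → ⊥
    no-cone {a} τa τb Fb Rb adj = t≢f (∧-l kr) (subst (λ z → R z ≡ false)
      (sym (flip-unique Fτ cτ τa τb Fb (not-t (∧-r kr)) (cone-face r (Fc-del Fτ a) adj))) Rb)

    mixed : ∀ a₀ a' {z z'} → adjExcept (del τ a₀) r z ≡ true → adjExcept (del τ z') r a' ≡ true →
      del (del τ a₀) a' z ≡ true → z ≢ z' → ∀ w → del τ a₀ w ≡ true → edgeB r w ≡ true
    mixed a₀ a' {z} {z'} k k' cz zz' w dw with w ≟ z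
    ... | no wz = adjExcept-e {del τ a₀} {r} {z} k w dw wz
    ... | yes refl = adjExcept-e {del τ z'} {r} {a'} k' w (∧-i (∧-l dw) (not-i (eqb-≢ zz'))) (eqb-false (not-t (∧-r cz)))

    both : ∀ a' {z₁ z₂} → adjExcept (del τ z₁) r a' ≡ true → adjExcept (del τ z₂) r a' ≡ true →
      z₁ ≢ z₂ → ∀ w → del τ a' w ≡ true → edgeB r w ≡ true
    both a' {z₁} {z₂} k₁ k₂ nz w dw with w ≟ z₁
    ... | no wz = adjExcept-e {del τ z₁} {r} {a'} k₁ w (∧-i (∧-l dw) (not-i (eqb-≢ wz))) (eqb-false (not-t (∧-r dw)))
    ... | yes refl = adjExcept-e {del τ z₂} {r} {a'} k₂ w (∧-i (∧-l dw) (not-i (eqb-≢ nz))) (eqb-false (not-t (∧-r dw)))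

  -- Pigeonhole bookkeeping for 'meets→guarded': for a facet τ with flips
  -- b₀ ∉ R at a₀ and b' ∉ R at a' ≠ a₀, a vertex r ∈ R - τ "kills" z if it is
  -- adjacent to all of τ - {a₀, z} or to all of τ - {z, a'}; it kills at most
  -- one z ∈ τ - {a₀, a'}, since killing two would make r a second flip.
  Kills : (Fin n → Bool) → Fin n → Fin n → Fin n → Fin n → Bool
  Kills τ a₀ a' r z = adjExcept (del τ a₀) r z ∨ adjExcept (del τ z) r a'

  kills-at-most-one : ∀ {τ a₀ a' b₀ b'} → Fc τ → cnt τ ≡ d →
    τ a₀ ≡ true → τ b₀ ≡ false → Fc (add (del τ a₀) b₀) → R b₀ ≡ false →
    τ a' ≡ true → τ b' ≡ false → Fc (add (del τ a') b') → R b' ≡ false →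
    ∀ r z₁ z₂ → R r ∧ not (τ r) ≡ true → del (del τ a₀) a' z₁ ≡ true → del (del τ a₀) a' z₂ ≡ true →
    Kills τ a₀ a' r z₁ ≡ true → Kills τ a₀ a' r z₂ ≡ true → z₁ ≡ z₂
  kills-at-most-one {τ} {a₀} {a'} {b₀} {b'} Fτ cτ τa₀ τb₀ Fb₀ Rb₀ τa' τb' Fb' Rb' r z₁ z₂ kr c₁ c₂ k₁ k₂
    with z₁ ≟ z₂
  ... | yes e = e
  ... | no nz with ∨-e {adjExcept (del τ a₀) r z₁} k₁ | ∨-e {adjExcept (del τ a₀) r z₂} k₂
  ...   | inj₁ x₁ | inj₁ x₂ = ⊥-elim (no-cone τa₀ τb₀ Fb₀ Rb₀ (adjExcept-two {del τ a₀} {r} nz x₁ x₂))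
    where open KillerFacts Fτ cτ r kr
  ...   | inj₁ x₁ | inj₂ x₂ = ⊥-elim (no-cone τa₀ τb₀ Fb₀ Rb₀ (mixed a₀ a' x₁ x₂ c₁ nz))
    where open KillerFacts Fτ cτ r kr
  ...   | inj₂ x₁ | inj₁ x₂ = ⊥-elim (no-cone τa₀ τb₀ Fb₀ Rb₀ (mixed a₀ a' x₂ x₁ c₂ (λ e → nz (sym e))))
    where open KillerFacts Fτ cτ r kr
  ...   | inj₂ x₁ | inj₂ x₂ = ⊥-elim (no-cone τa' τb' Fb' Rb' (both a' x₁ x₂ nz))
    where open KillerFacts Fτ cτ r kr

  -- A facet τ ⊆ R with a flip b₀ ∈ C is guarded: the flip at any a' ≠ a₀ is
  -- reached from b₀ by two flip transfers through a quiet vertex z of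
  -- τ - {a₀, a'} (pigeonhole: R - τ has at most d - 3 vertices).
  meets→guarded : ∀ {τ a₀ b₀} → Fc τ → cnt τ ≡ d → InR τ → τ a₀ ≡ true →
    τ b₀ ≡ false → Fc (add (del τ a₀) b₀) → C b₀ ≡ true → Guarded τ
  meets→guarded {τ} {a₀} {b₀} Fτ cτ Rτ τa₀ τb₀ Fb₀ Cb₀ a' b' τa' τb' Fb' Rb' with a₀ ≟ a'
  ... | yes refl = subst (λ z → C z ≡ true) (sym (flip-unique Fτ cτ τa₀ τb₀ Fb₀ τb' Fb')) Cb₀
  ... | no ne = at-quiet (pigeon cand kil (Kills τ a₀ a') (kills-at-most-one Fτ cτ τa₀ τb₀ Fb₀ (C-notR b₀ Cb₀) τa' τb' Fb' Rb') fewer)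
    where
    cand kil : Fin n → Bool
    cand = del (del τ a₀) a'
    kil r = R r ∧ not (τ r)
    cand-size : cnt cand + 2 ≡ d
    cand-size = del-size (del τ a₀) a' 1 (trans (del-other τ a₀ a' (λ e → ne (sym e))) τa') (ridge-size {τ} {a₀} cτ τa₀)
    fewer : cnt kil < cnt cand
    fewer = fewer-killers (cnt kil) (cnt τ) (cnt cand) 2 d (subst (λ k → k + 3 ≤ d + d) (R-split τ Rτ) hR) cand-size
              (≤-reflexive (cong (_+ 2) (sym cτ)))
    at-quiet : (Σ (Fin n) λ z → cand z ≡ true × (∀ r → kil r ≡ true → Kills τ a₀ a' r z ≡ false)) → C b' ≡ true
    at-quiet (z , cz , unkilled) = via-z (flip Fτ cτ τz)
      where
      τz : τ z ≡ true
      τz = ∧-l (∧-l cz)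
      a₀≢z : a₀ ≢ z
      a₀≢z e = eqb-false (not-t (∧-r (∧-l {τ z ∧ not (eqb z a₀)} cz))) (sym e)
      z≢a' : z ≢ a'
      z≢a' = eqb-false (not-t (∧-r cz))
      quiet₁ : ∀ r → R r ≡ true → τ r ≡ false → adjExcept (del τ a₀) r z ≡ false
      quiet₁ r rr τr = proj₁ (∨-false (unkilled r (∧-i rr (not-i τr))))
      quiet₂ : ∀ r → R r ≡ true → τ r ≡ false → adjExcept (del τ z) r a' ≡ false
      quiet₂ r rr τr = proj₂ (∨-false (unkilled r (∧-i rr (not-i τr))))
      via-z : (Σ (Fin n) λ b → τ b ≡ false × Fc (add (del τ z) b)) → C b' ≡ true
      via-z (b , τb , Fb) = flip-transfer Fτ cτ Rτ z≢a' τz τa' quiet₂ τb Fb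
        (flip-transfer Fτ cτ Rτ a₀≢z τa₀ τz quiet₁ τb₀ Fb₀ Cb₀ τb Fb) τb' Fb'

  -- Link parity at σ = ρ - a' for a ridge ρ with apexes a, t whose two facets
  -- lie in R, when no R-vertex outside ρ ∪ {a, t} is adjacent to all of σ:
  -- the R-vertices of the link are a, a', t, of degrees [b ∈ C], 0 and
  -- [b₂ ∈ C] for the flips b, b₂ of ρ ∪ {a}, ρ ∪ {t} at a'.  So b ∈ C forces b₂ ∈ C.
  flips-across : ∀ {ρ a t a' b b₂} → cnt ρ + 1 ≡ d → a ≢ t → ρ a ≡ false → ρ t ≡ false →
    Fc (add ρ a) → Fc (add ρ t) → InR (add ρ a) → InR (add ρ t) → ρ a' ≡ true →
    (∀ r → R r ≡ true → add (add ρ a) t r ≡ false → adjExcept ρ r a' ≡ false) →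
    add ρ a b ≡ false → Fc (add (del (add ρ a) a') b) → C b ≡ true →
    add ρ t b₂ ≡ false → Fc (add (del (add ρ t) a') b₂) → C b₂ ≡ true
  flips-across {ρ} {a} {t} {a'} {b} {b₂} cρ a≢t ρa ρt F₁ F₂ R₁ R₂ ρa' quiet τ₁b Fb Cb τ₂b₂ Fb₂ =
    even-1+ _ (subst (λ k → par k ≡ false) sum-Sp (restricted-even Sp only-Sp))
    where
    a≢a' : a ≢ a'
    a≢a' e = t≢f ρa' (subst (λ z → ρ z ≡ false) e ρa)
    t≢a' : t ≢ a'
    t≢a' e = t≢f ρa' (subst (λ z → ρ z ≡ false) e ρt)
    σ : Fin n → Bool
    σ = del ρ a'
    open LinkParity σ (del-size ρ a' 1 ρa' cρ) (λ i e → R₁ i (∨-l (eqb i a) (∧-l e)))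
    Sp : Fin n → Bool
    Sp s = (eqb s a ∨ eqb s a') ∨ eqb s t
    only-Sp : ∀ s → R s ≡ true → σ s ≡ false → Fc (add σ s) → Sp s ≡ true
    only-Sp s rs σs fs with bdec (eqb s a) | bdec (eqb s a') | bdec (eqb s t)
    ... | inj₁ e | _ | _ = ∨-l (eqb s t) (∨-l (eqb s a') e)
    ... | inj₂ _ | inj₁ e | _ = ∨-l (eqb s t) (∨-r (eqb s a) e)
    ... | inj₂ _ | inj₂ _ | inj₁ e = ∨-r (eqb s a ∨ eqb s a') e
    ... | inj₂ sa | inj₂ sa' | inj₂ st with bdec (ρ s)
    ...   | inj₁ ρs = ⊥-elim (t≢f (∧-i ρs (not-i sa')) σs)
    ...   | inj₂ ρs = ⊥-elim (t≢f (link-adjExcept {ρ} {a'} {s} σs fs)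
              (quiet s rs (trans (cong (λ v → (v ∨ eqb s a) ∨ eqb s t) ρs) (trans (cong (_∨ eqb s t) sa) st))))
    disjoint : ∀ i → (eqb i a ∨ eqb i a') ∧ eqb i t ≡ false
    disjoint i with i ≟ t
    ... | no _ = ∧-zeroʳ (eqb i a ∨ eqb i a')
    ... | yes refl rewrite eqb-≢ (λ e → a≢t (sym e)) | eqb-≢ t≢a' = refl
    back : ∀ i → add σ a' i ≡ ρ i
    back = del-add ρ a' ρa'
    -- both facets through ρ = σ ∪ {a'} lie in R, so a' has no good link edge
    degree-a' : degree a' ≡ 0
    degree-a' = trans
      (degree-ridge a' (del-self ρ a') a≢t (trans (back a) ρa) (trans (back t) ρt)
        (Fc-ext (λ i → cong (_∨ eqb i a) (sym (back i))) F₁) (Fc-ext (λ i → cong (_∨ eqb i t) (sym (back i))) F₂))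
      (cong₂ _+_ (cong b2n (trans (meetsC-ext (λ i → cong (_∨ eqb i a) (back i))) (meetsC-R R₁)))
                 (cong b2n (trans (meetsC-ext (λ i → cong (_∨ eqb i t) (back i))) (meetsC-R R₂))))
    degree-a : degree a ≡ 1
    degree-a = trans (degree-facet a a' b (add ρ a) (subst (λ v → v ∧ not (eqb a a') ≡ false) (sym ρa) refl)
                       (add-del-comm ρ a' a a≢a') F₁ R₁ (∨-l (eqb a' a) ρa') τ₁b Fb)
                     (cong b2n Cb)
    degree-t : degree t ≡ b2n (C b₂)
    degree-t = degree-facet t a' b₂ (add ρ t) (subst (λ v → v ∧ not (eqb t a') ≡ false) (sym ρt) refl)
                 (add-del-comm ρ a' t t≢a') F₂ R₂ (∨-l (eqb a' t) ρa') τ₂b₂ Fb₂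
    sum-Sp : sumF (λ s → ite (Sp s) (degree s)) ≡ (1 + 0) + b2n (C b₂)
    sum-Sp = trans (sumF-ite∨ degree (λ s → eqb s a ∨ eqb s a') (λ s → eqb s t) disjoint)
      (cong₂ _+_ (trans (sumF-ite∨ degree (λ s → eqb s a) (λ s → eqb s a') (eqb-disj a≢a'))
                    (cong₂ _+_ (trans (sumF-ite1 degree a) degree-a) (trans (sumF-ite1 degree a') degree-a')))
                 (trans (sumF-ite1 degree t) degree-t))

  -- Choose a quiet vertex a' of ρ; the flip b of
  -- ρ ∪ {a} at a' is outside R (b is adjacent to all of ρ - a') and distinct
  -- from t (b is adjacent to a), so b ∈ C; 'flips-across' moves this to the flip
  -- of ρ ∪ {t} at a', and 'meets→guarded' finishes.
  guarded-across : ∀ {ρ a t} → Fc ρ → cnt ρ + 1 ≡ d → a ≢ t → ρ a ≡ false → ρ t ≡ false →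
    Fc (add ρ a) → Fc (add ρ t) → InR (add ρ a) → InR (add ρ t) → Guarded (add ρ a) → Guarded (add ρ t)
  guarded-across {ρ} {a} {t} Fρ cρ a≢t ρa ρt F₁ F₂ R₁ R₂ g₁ = at-quiet (quiet-vertex kil fewer no-cone)
    where
    τ₁ : Fin n → Bool
    τ₁ = add ρ a
    size₁ : cnt τ₁ ≡ d
    size₁ = trans (cnt-add ρ a ρa) (trans (+-comm 1 (cnt ρ)) cρ)
    size₂ : cnt (add ρ t) ≡ d
    size₂ = trans (cnt-add ρ t ρt) (trans (+-comm 1 (cnt ρ)) cρ)
    τ₁t : τ₁ t ≡ false
    τ₁t rewrite ρt = eqb-≢ (λ e → a≢t (sym e))
    kil : Fin n → Bool
    kil r = R r ∧ not (add τ₁ t r)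
    R-τ₁t : InR (add τ₁ t)
    R-τ₁t i e with ∨-e {τ₁ i} e
    ... | inj₁ x = R₁ i x
    ... | inj₂ x = R₂ i (∨-r (ρ i) x)
    fewer : cnt kil < cnt ρ
    fewer = fewer-killers (cnt kil) (cnt (add τ₁ t)) (cnt ρ) 1 d (subst (λ k → k + 3 ≤ d + d) (R-split (add τ₁ t) R-τ₁t) hR) cρ
      (subst (λ m → d + 1 ≤ m + 2) (sym (trans (cnt-add τ₁ t τ₁t) (cong suc size₁)))
             (≤-trans (≤-reflexive (+-comm d 1)) (m≤m+n (suc d) 2)))
    -- a killer adjacent to all of ρ would be a third apex of ρ
    no-cone : ∀ r → kil r ≡ true → (∀ w → ρ w ≡ true → edgeB r w ≡ true) → ⊥
    no-cone r kr adj = [ (λ e → t≢f (subst (λ z → add τ₁ t z ≡ true) (sym e) (∨-l (eqb a t) (add-self ρ a))) outside)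
                       , (λ e → t≢f (subst (λ z → add τ₁ t z ≡ true) (sym e) (add-self τ₁ t)) outside) ]′
                       (apexOnly ρ Fρ cρ a≢t ρa ρt F₁ F₂ r (proj₁ (∨-false (proj₁ (∨-false outside)))) (cone-face r Fρ adj))
      where
      outside : add τ₁ t r ≡ false
      outside = not-t (∧-r kr)
    at-quiet : (Σ (Fin n) λ a' → ρ a' ≡ true × (∀ r → kil r ≡ true → adjExcept ρ r a' ≡ false)) → Guarded (add ρ t)
    at-quiet (a' , ρa' , quiet) = use-flips (flip F₁ size₁ (∨-l (eqb a' a) ρa')) (flip F₂ size₂ (∨-l (eqb a' t) ρa'))
      where
      quiet' : ∀ r → R r ≡ true → add τ₁ t r ≡ false → adjExcept ρ r a' ≡ false
      quiet' r rr out = quiet r (∧-i rr (not-i out))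
      a≢a' : a ≢ a'
      a≢a' e = t≢f ρa' (subst (λ z → ρ z ≡ false) e ρa)
      use-flips : (Σ (Fin n) λ b → τ₁ b ≡ false × Fc (add (del τ₁ a') b)) →
                  (Σ (Fin n) λ b → add ρ t b ≡ false × Fc (add (del (add ρ t) a') b)) → Guarded (add ρ t)
      use-flips (b , τ₁b , Fb) (b₂ , τ₂b₂ , Fb₂) = meets→guarded F₂ size₂ R₂ (∨-l (eqb a' t) ρa') τ₂b₂ Fb₂
          (flips-across cρ a≢t ρa ρt F₁ F₂ R₁ R₂ ρa' quiet' τ₁b Fb (g₁ a' b (∨-l (eqb a' a) ρa') τ₁b Fb Rb) τ₂b₂ Fb₂)
        where
        b≢a : b ≢ a
        b≢a e = t≢f (subst (λ z → τ₁ z ≡ true) (sym e) (add-self ρ a)) τ₁b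
        -- a and b lie in a common face, while the apexes a, t of ρ are not adjacent
        b≢t : b ≢ t
        b≢t e = apexes-nonadjacent fl ρa ρt a≢t cρ F₁ F₂ (subst (λ z → edgeB a z ≡ true) e
          (face-edge Fb a b (∨-l (eqb a b) (trans (del-other τ₁ a' a a≢a') (add-self ρ a))) (add-self (del τ₁ a') b)
                     (λ e' → b≢a (sym e'))))
        -- b ∉ R, since otherwise b would be a killer adjacent to all of ρ - a'
        Rb : R b ≡ false
        Rb with bdec (R b)
        ... | inj₂ x = x
        ... | inj₁ x = ⊥-elim (t≢f (link-adjExcept {ρ} {a'} {b} σb Fσb) (quiet' b x (trans (cong (_∨ eqb b t) τ₁b) (eqb-≢ b≢t))))
          where
          σb : del ρ a' b ≡ false
          σb = cong (_∧ not (eqb b a')) (proj₁ (∨-false {ρ b} τ₁b))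
          below : ∀ i → add (del ρ a') b i ≡ true → add (del τ₁ a') b i ≡ true
          below i e with ∨-e {del ρ a' i} e
          ... | inj₁ σi = ∨-l (eqb i b) (trans (sym (add-del-comm ρ a' a a≢a' i)) (∨-l (eqb i a) σi))
          ... | inj₂ ib = ∨-r (del τ₁ a' i) ib
          Fσb : Fc (add (del ρ a') b)
          Fσb = Fc-down below Fb

  Good : (Fin n → Bool) → Set
  Good f = meetsC f ≡ true ⊎ (InR f × Guarded f)

  Guarded-ext : ∀ {f g} → (∀ i → f i ≡ g i) → Guarded f → Guarded g
  Guarded-ext {f} {g} e gf a y ga gy Fy Ry =
    gf a y (trans (e a) ga) (trans (e y) gy) (Fc-ext (λ i → cong (λ b → (b ∧ not (eqb i a)) ∨ eqb i y) (sym (e i))) Fy) Ry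

  InR-ext : ∀ {f g} → (∀ i → f i ≡ g i) → InR f → InR g
  InR-ext e h i gi = h i (trans (e i) gi)

  good-across-ridge : ∀ {s t} → Fc s → Fc t → cnt t ≡ d → Adj s t → Good s → Good t
  good-across-ridge {s} {t} Fs Ft ct A good-s = go good-s (search (λ w → t w ∧ not (R w)))
    where
    open Adj A
    ρ : Fin n → Bool
    ρ i = s i ∧ t i
    Fx : Fc (add ρ x)
    Fx = Fc-ext eqs Fs
    Fy : Fc (add ρ y)
    Fy = Fc-ext eqt Ft
    sy : s y ≡ false
    sy = trans (eqs y) (trans (cong (_∨ eqb y x) ρy) (eqb-≢ (λ e → x≢y (sym e))))
    tx : t x ≡ false
    tx = trans (eqt x) (trans (cong (_∨ eqb x y) ρx) (eqb-≢ x≢y))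
    go : Good s → (∃ λ w → t w ∧ not (R w) ≡ true) ⊎ (∀ w → t w ∧ not (R w) ≡ false) → Good t
    go (inj₁ m) (inj₁ (w , e)) = inj₁ (trans (meetsC-ext eqt)
       (meets-across Fρ cρ x≢y ρx ρy Fx Fy (trans (meetsC-ext (λ i → sym (eqs i))) m)
         (w , trans (sym (eqt w)) (∧-l e) , not-t (∧-r e))))
    -- s meets C and t ⊆ R: the flip x of t lies in C, so t is guarded
    go (inj₁ m) (inj₂ h) = inj₂ (Rt , meets→guarded Ft ct Rt ty tx (Fc-ext (λ i → sym (dty i)) Fs) x∈C)
      where
      Rt : InR t
      Rt = InR-of t h
      x∈C : C x ≡ true
      x∈C with meetsC-e {s} m
      ... | c , sc , Cc with ∨-e {ρ c} (trans (sym (eqs c)) sc)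
      ...   | inj₁ ρc = ⊥-elim (t≢f Cc (R→notC c (Rt c (∧-r ρc))))
      ...   | inj₂ e = subst (λ z → C z ≡ true) (eqb-≡ e) Cc
      ty : t y ≡ true
      ty = trans (eqt y) (add-self ρ y)
      dty : ∀ i → add (del t y) x i ≡ s i
      dty i = trans (cong (_∨ eqb i x) (trans (cong (λ b → b ∧ not (eqb i y)) (eqt i)) (add-del ρ y ρy i))) (sym (eqs i))
    -- s ⊆ R guarded and t ⊄ R: the vertex of t outside R is the flip y of s
    go (inj₂ (Rs , gs)) (inj₁ (w , e)) = inj₁ (meetsC-at {t} y (trans (eqt y) (add-self ρ y)) Cy)
      where
      wy : w ≡ y
      wy with ∨-e {ρ w} (trans (sym (eqt w)) (∧-l e))
      ... | inj₁ ρw = ⊥-elim (t≢f (Rs w (∧-l ρw)) (not-t (∧-r e)))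
      ... | inj₂ e' = eqb-≡ e'
      dsx : ∀ i → add (del s x) y i ≡ t i
      dsx i = trans (cong (_∨ eqb i y) (trans (cong (λ b → b ∧ not (eqb i x)) (eqs i)) (add-del ρ x ρx i))) (sym (eqt i))
      Cy : C y ≡ true
      Cy = gs x y (trans (eqs x) (add-self ρ x)) sy (Fc-ext (λ i → sym (dsx i)) Ft) (subst (λ z → R z ≡ false) wy (not-t (∧-r e)))
    go (inj₂ (Rs , gs)) (inj₂ h) = inj₂ (Rt , Guarded-ext (λ i → sym (eqt i))
         (guarded-across Fρ cρ x≢y ρx ρy Fx Fy (InR-ext eqs Rs) (InR-ext eqt Rt) (Guarded-ext eqs gs)))
      where
      Rt : InR t
      Rt = InR-of t h

  good-adjacent : ∀ {σ τ} → Facet Δ σ → Facet Δ τ → Adjacent Δ σ τ → Good (lookup σ) → Good (lookup τ)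
  good-adjacent fσ fτ adj = good-across-ridge (Face→Fc (proj₁ fσ)) (Face→Fc (proj₁ fτ)) (facet-cnt fτ) (adjUnpack fσ fτ adj)

  good-chain : ∀ {a b} → StrongChain Δ a b → Good (lookup a) → Good (lookup b)
  good-chain [ _ ] h = h
  good-chain ((fa , adj) ∷ rest) h = good-chain rest (good-adjacent fa (head-facet rest) adj h)
    where
    head-facet : ∀ {a b} → StrongChain Δ a b → Facet Δ a
    head-facet [ f ] = f
    head-facet ((f , _) ∷ _) = f

  -- Every vertex v ∉ R of a facet reached by a strong chain from a facet
  -- meeting C lies in C: the final facet is good but, containing v, not ⊆ R.
  reached : ∀ {Fu Fv u v} → Facet Δ Fu → Facet Δ Fv → lookup Fu u ≡ true → C u ≡ true →
    lookup Fv v ≡ true → R v ≡ false → C v ≡ true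
  reached {Fu} {Fv} {u} {v} fu fv uu Cu vv Rv
    with good-chain (proj₁ (proj₂ pm) Fu Fv fu fv) (inj₁ (meetsC-at {lookup Fu} u uu Cu))
  ... | inj₂ (Rs , _) = ⊥-elim (t≢f (Rs v vv) Rv)
  ... | inj₁ m with meetsC-e {lookup Fv} m
  ...   | c , fc , Cc with c ≟ v
  ...     | yes refl = Cc
  ...     | no ne = C-closed c v Cc (face-edge (Face→Fc (proj₁ fv)) c v fc vv ne) Rv

-- The vertices reachable from u in G(Δ) - R, as the union of the balls
-- 'ball k' (vertices reachable by at most k edges); the balls stop growing
-- after at most n steps.
module Component {n : ℕ} (Δ : SimplicialComplex n) (Rs : Subset n) (u : Fin n) (u∉ : u ∉ Rs) where
  open Complex Δ

  R : Fin n → Bool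
  R = lookup Rs

  ball : ℕ → Fin n → Bool
  ball zero w = eqb w u
  ball (suc k) w = ball k w ∨ (not (R w) ∧ anyb (λ w' → ball k w' ∧ edgeB w' w))

  snoc : ∀ {a b c} → PathAvoiding (Edge Δ) Rs a b → Edge Δ b c → c ∉ Rs → PathAvoiding (Edge Δ) Rs a c
  snoc (here a∉) e c∉ = step a∉ e (here c∉)
  snoc (step a∉ e p) e' c∉ = step a∉ e (snoc p e' c∉)

  ball-path : ∀ k w → ball k w ≡ true → PathAvoiding (Edge Δ) Rs u w
  ball-path zero w e = subst (PathAvoiding (Edge Δ) Rs u) (sym (eqb-≡ e)) (here u∉)
  ball-path (suc k) w e with ∨-e {ball k w} e
  ... | inj₁ x = ball-path k w x
  ... | inj₂ x with anyb-e _ (∧-r {not (R w)} x)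
  ...   | w' , y = snoc (ball-path k w' (∧-l {ball k w'} y)) (→edge (∧-r {ball k w'} y)) (→∉ (not-t (∧-l {not (R w)} x)))

  path-end : ∀ {a b} → PathAvoiding (Edge Δ) Rs a b → b ∉ Rs
  path-end (here x) = x
  path-end (step _ _ p) = path-end p

  Stable : ℕ → Set
  Stable k = ∀ w → ball (suc k) w ≡ true → ball k w ≡ true

  stable-or-large : ∀ k → (Σ ℕ Stable) ⊎ (k + 1 ≤ cnt (ball k))
  stable-or-large zero = inj₂ (subst (1 ≤_) (sym (cnt-single u)) ≤-refl)
  stable-or-large (suc k) with stable-or-large k
  ... | inj₁ s = inj₁ s
  ... | inj₂ le with search (λ w → ball (suc k) w ∧ not (ball k w))
  ...   | inj₂ h = inj₁ (k , λ w e → old w e (h w))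
    where
    old : ∀ w → ball (suc k) w ≡ true → ball (suc k) w ∧ not (ball k w) ≡ false → ball k w ≡ true
    old w e f rewrite e with ball k w
    ... | true = refl
  ...   | inj₁ (w , e) = inj₂ (≤-trans (s≤s le) (cnt-strict w (λ i → ∨-l _) (∧-l e) (not-t (∧-r e))))

  stable : Σ ℕ Stable
  stable with stable-or-large n
  ... | inj₁ s = s
  ... | inj₂ le = ⊥-elim (1+n≰n (≤-trans (subst (_≤ cnt (ball n)) (+-comm n 1) le) (cnt≤n (ball n))))

  C : Fin n → Bool
  C = ball (proj₁ stable)

  C-notR : ∀ i → C i ≡ true → R i ≡ false
  C-notR i e = ∉→ (path-end (ball-path (proj₁ stable) i e))

  C-closed : ∀ i j → C i ≡ true → edgeB i j ≡ true → R j ≡ false → C j ≡ true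
  C-closed i j ci e rj = proj₂ stable j (∨-r (C j) (∧-i (not-i rj) (anyb-i _ i (∧-i ci e))))

  u∈C : C u ≡ true
  u∈C = in-ball (proj₁ stable)
    where
    in-ball : ∀ k → ball k u ≡ true
    in-ball zero = eqb-refl u
    in-ball (suc k) = ∨-l _ (in-ball k)

removal-bound : ∀ r d → r < 2 * d ∸ 2 → r + 3 ≤ d + d
removal-bound r d lt = subst (r + 3 ≤_) (double d) (below (2 * d) lt)
  where
  below : ∀ m → suc r ≤ m ∸ 2 → r + 3 ≤ m
  below (suc (suc m)) le = subst (_≤ suc (suc m)) (+-comm 3 r) (s≤s (s≤s le))
  double : ∀ d → 2 * d ≡ d + d
  double = solve-∀

connected-after-removal : ∀ (d n : ℕ) → 1 ≤ d → (Δ : SimplicialComplex n) → IsFlag Δ → IsPseudomanifold Δ d →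
  ∀ (R : Subset n) → ∣ R ∣ < 2 * d ∸ 2 → ∀ u v → u ∉ R → v ∉ R → PathAvoiding (Edge Δ) R u v
connected-after-removal d n 1≤d Δ fl pm Rs lt u v u∉ v∉ with facet-through 1≤d u | facet-through 1≤d v
  where open Pseudomanifold Δ d pm
... | Fu , fu , uu | Fv , fv , vv = ball-path (proj₁ stable) v
  (reached fu fv uu u∈C vv (∉→ v∉))
  where
  open Component Δ Rs u u∉
  hR : cnt R + 3 ≤ d + d
  hR = removal-bound (cnt R) d (subst (λ k → k < 2 * d ∸ 2) (card Rs) lt)
  open Propagation Δ d fl pm R hR C C-notR C-closed

two-vertex-path : ∀ {n} (Δ : SimplicialComplex n) (Rs : Subset n) {a y} → a ≢ y → ¬ Edge Δ a y →
  (∀ w → w ∉ Rs → w ≡ a ⊎ w ≡ y) → ¬ PathAvoiding (Edge Δ) Rs a y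
two-vertex-path Δ Rs ne na only (here _) = ne refl
two-vertex-path Δ Rs ne na only (step _ e p) with only _ (path-start p)
  where
  path-start : ∀ {b c} → PathAvoiding (Edge Δ) Rs b c → b ∉ Rs
  path-start (here x) = x
  path-start (step x _ _) = x
... | inj₁ refl = proj₁ e refl
... | inj₂ refl = na e

all-but-two : ∀ {n} d {a y : Fin n} → a ≢ y → ¬ (2 * d ∸ 2 + 1 ≤ n) →
  Σ (Subset n) λ Rs → ∣ Rs ∣ < 2 * d ∸ 2 × a ∉ Rs × y ∉ Rs × (∀ w → w ∉ Rs → w ≡ a ⊎ w ≡ y)
all-but-two {n} d {a} {y} a≢y few =
  Rs , small , →∉ (kept a (∨-l (eqb a y) (eqb-refl a))) , →∉ (kept y (∨-r (eqb y a) (eqb-refl y))) , only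
  where
  ay : Fin n → Bool
  ay i = eqb i a ∨ eqb i y
  Rs : Subset n
  Rs = tabulate (λ i → not (ay i))
  kept : ∀ w → ay w ≡ true → lookup Rs w ≡ false
  kept w e = trans (lk-tab (λ i → not (ay i)) w) (cong not e)
  only : ∀ w → w ∉ Rs → w ≡ a ⊎ w ≡ y
  only w w∉ with ∨-e {eqb w a} (not-false (trans (sym (lk-tab (λ i → not (ay i)) w)) (∉→ w∉)))
    where
    not-false : ∀ {b} → not b ≡ false → b ≡ true
    not-false {true} _ = refl
  ... | inj₁ e = inj₁ (eqb-≡ e)
  ... | inj₂ e = inj₂ (eqb-≡ e)
  two : cnt ay ≡ 2
  two = sym (trans (cong₂ _+_ (sym (cnt-single a)) (sym (cnt-single y)))
          (trans (cnt-ie (λ i → eqb i a) (λ i → eqb i y)) (trans (cong (cnt ay +_) (cnt-zero (eqb-disj a≢y))) (+-identityʳ _))))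
  rest : cnt (λ i → not (ay i)) + 2 ≡ n
  rest = trans (+-comm _ 2) (trans (cong (_+ cnt (λ i → not (ay i))) (sym two))
           (trans (sym (cnt-split (λ _ → true) ay)) (sumF-const1 {n})))
  small : ∣ Rs ∣ < 2 * d ∸ 2
  small = subst (_< 2 * d ∸ 2) (sym (trans (card Rs) (cnt-ext (lk-tab (λ i → not (ay i))))))
    (≤-trans (subst (suc (cnt (λ i → not (ay i))) ≤_) rest (≤-trans (n≤1+n _) (≤-reflexive (+-comm 2 _))))
             (≤-pred (subst (suc n ≤_) (+-comm (2 * d ∸ 2) 1) (≰⇒> few))))

-- First half of (2d-2)-connectivity: n ≥ 2d - 1.  For d = 1 a facet is a
-- vertex; for d ≥ 2, if n ≤ 2d - 2 then deleting all vertices but a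
-- non-adjacent pair would separate them, contradicting connectivity.
enough-vertices : ∀ (d n : ℕ) → 1 ≤ d → (Δ : SimplicialComplex n) → IsFlag Δ → IsPseudomanifold Δ d →
  2 * d ∸ 2 + 1 ≤ n
enough-vertices (suc zero) n _ Δ fl pm = subst (_≤ n) (trans (sym (card σ₀)) σ₀-size) (cnt≤n (lookup σ₀))
  where open Pseudomanifold Δ 1 pm
enough-vertices d@(suc (suc _)) n 1≤d Δ fl pm with 2 * d ∸ 2 + 1 ≤? n
... | yes enough = enough
... | no few with nonadjacent-pair 1≤d fl
  where open Pseudomanifold Δ d pm
...   | a , y , a≢y , no-edge with all-but-two d a≢y few
...     | Rs , small , a∉ , y∉ , only =
  ⊥-elim (two-vertex-path Δ Rs a≢y no-edge only (connected-after-removal d n 1≤d Δ fl pm Rs small a y a∉ y∉))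

theorem1p1 : ∀ (d n : ℕ) → 1 ≤ d → (Δ : SimplicialComplex n) →
    IsFlag Δ → IsPseudomanifold Δ d →
    IsConnectedGraph (Edge Δ) (2 * d ∸ 2)
theorem1p1 d n 1≤d Δ fl pm = enough-vertices d n 1≤d Δ fl pm , connected-after-removal d n 1≤d Δ fl pm
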